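{- Let $L_1,L_2\ge 1$ and $S_1,S_2\ge 0$ be integers with $L_i+S_i\ge 2$ for $i=1,2$, and assume $\gcd(L_1,S_1,L_2,S_2)>1$. Then the two-dimensional sequence $\big(\xi_{L_1,S_1}^n,\xi_{L_2,S_2}^n\big)_{n\ge 0}$ is not dense in $[0,1]^2$.
   Context: LS-sequence of points. Let $L\ge 1$, $S\ge 0$ be integers with $L+S\ge 2$, and let $\beta\in(0,1)$ be the unique positive solution of $L\beta+S\beta^2=1$. Define $t_0=1$, $t_1=L+S$, $l_0=1$, $l_1=L$ and $t_n=Lt_{n-1}+St_{n-2}$, $l_n=Ll_{n-1}+Sl_{n-2}$ for $n\ge 2$. The LS-sequence $(\xi_{L,S}^N)_{N\ge 0}$ in $[0,1)$ is defined by $\xi_{L,S}^0=0$ and, for $n\ge 0$ and $t_n\le N<t_{n+1}$, writing uniquely $N=t_n+\eta l_n+r$ with $0\le\eta\le L+S-2$, $0\le r<l_n$: $$\xi_{L,S}^N=\xi_{L,S}^r+\beta^{n+1}\min\{L,\eta+1\}+\beta^{n+2}\max\{\eta+1-L,0\}.$$ (For $S=0$ this is the van der Corput sequence in base $L$.) -}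

module Defs where

open import Data.Nat as ℕ using (ℕ; zero; suc; _≤ᵇ_; _∸_; _⊓_; _⊔_)
open import Data.Nat.DivMod using (_/_; _%_)
open import Data.Integer as ℤ using (ℤ; +_)
open import Data.Rational as ℚ using (ℚ; 0ℚ; _<_; _≤_)
open import Data.Bool using (if_then_else_)
open import Data.Product using (_×_; _,_; proj₁; proj₂; ∃-syntax)
open import Data.Sum using (_⊎_)

ℕtoℚ : ℕ → ℚ
ℕtoℚ n = (+ n) ℚ./ 1

-- q / d for a natural number d (only used with d ≥ 1; returns 0 for d = 0)
divℕ : ℚ → ℕ → ℚ
divℕ q zero    = 0ℚ
divℕ q (suc k) = q ℚ.* ((+ 1) ℚ./ suc k)

-- The recursive sequences t_n and l_n (returned as the pair (t_n , t_{n+1}) etc.)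
tPair : ℕ → ℕ → ℕ → ℕ × ℕ
tPair L S zero    = 1 , L ℕ.+ S
tPair L S (suc n) = let (a , b) = tPair L S n in b , L ℕ.* b ℕ.+ S ℕ.* a

lPair : ℕ → ℕ → ℕ → ℕ × ℕ
lPair L S zero    = 1 , L
lPair L S (suc n) = let (a , b) = lPair L S n in b , L ℕ.* b ℕ.+ S ℕ.* a

t : ℕ → ℕ → ℕ → ℕ
t L S n = proj₁ (tPair L S n)

l : ℕ → ℕ → ℕ → ℕ
l L S n = proj₁ (lPair L S n)

-- Safe natural division / remainder (divisor 0 gives 0 / the number itself;
-- only used with l_n ≥ 1)
divN : ℕ → ℕ → ℕ
divN m zero    = 0
divN m (suc k) = m / suc k

modN : ℕ → ℕ → ℕ
modN m zero    = m
modN m (suc k) = m % suc k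

-- level L S N k : the largest j ≤ k with t_j ≤ N (0 if none).
-- For N ≥ 1, level L S N N is the unique n with t_n ≤ N < t_{n+1}
-- (t is strictly increasing with t_0 = 1, so t_j > N for j ≥ N).
level : ℕ → ℕ → ℕ → ℕ → ℕ
level L S N zero    = 0
level L S N (suc k) = if t L S (suc k) ≤ᵇ N then suc k else level L S N k

-- Exact arithmetic in ℚ(β), where β = β(L,S) is the unique positive root
-- of L β + S β² = 1.  A pair (a , b) represents the real number a + b β.

Qβ : Set
Qβ = ℚ × ℚ

zeroβ : Qβ
zeroβ = 0ℚ , 0ℚ

_⊕_ : Qβ → Qβ → Qβ
(a , b) ⊕ (c , d) = a ℚ.+ c , b ℚ.+ d

scale : ℕ → Qβ → Qβ
scale k (a , b) = ℕtoℚ k ℚ.* a , ℕtoℚ k ℚ.* b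

-- multiplication by β, using S β² = 1 - L β  (S > 0), resp. β = 1/L (S = 0)
mulβ : ℕ → ℕ → Qβ → Qβ
mulβ L zero    (a , b) = divℕ (a ℚ.+ divℕ b L) L , 0ℚ
mulβ L (suc s) (a , b) =
  divℕ b (suc s) , a ℚ.- divℕ (ℕtoℚ L ℚ.* b) (suc s)

powβ : ℕ → ℕ → ℕ → Qβ
powβ L S zero    = ℚ.1ℚ , 0ℚ
powβ L S (suc n) = mulβ L S (powβ L S n)

-- The LS-sequence, computed with fuel (the recursive call is on r < N).
ξF : ℕ → ℕ → ℕ → ℕ → Qβ
ξF L S zero       N = zeroβ
ξF L S (suc fuel) zero = zeroβ
ξF L S (suc fuel) N@(suc _) =
  let n = level L S N N
      m = N ∸ t L S n
      η = divN m (l L S n)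
      r = modN m (l L S n)
  in ξF L S fuel r
     ⊕ (scale (L ⊓ suc η) (powβ L S (suc n))
     ⊕ scale (suc η ∸ L) (powβ L S (suc (suc n))))

ξ : ℕ → ℕ → ℕ → Qβ
ξ L S N = ξF L S N N

-- Order on ℚ(β).  With D = L² + 4S and S > 0 we have
-- β = (√D - L)/(2S), so  c + b β > 0  ⇔  u + b √D > 0  with u = 2Sc - bL.
-- With S = 0, β = 1/L.

-- u + v √D > 0 (D ≥ 0), decided by squaring
PosSqrt : ℚ → ℚ → ℕ → Set
PosSqrt u v D =
    (0ℚ ≤ u × 0ℚ ≤ v × (0ℚ < u ⊎ 0ℚ < v))
  ⊎ (0ℚ ≤ u × v < 0ℚ × v ℚ.* v ℚ.* ℕtoℚ D < u ℚ.* u)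
  ⊎ (u < 0ℚ × 0ℚ < v × u ℚ.* u < v ℚ.* v ℚ.* ℕtoℚ D)

Positive : ℕ → ℕ → Qβ → Set
Positive L zero    (c , b) = 0ℚ < c ℚ.+ divℕ b L
Positive L (suc s) (c , b) =
  PosSqrt (ℕtoℚ (2 ℕ.* suc s) ℚ.* c ℚ.- ℕtoℚ L ℚ.* b) b (L ℕ.* L ℕ.+ 4 ℕ.* suc s)

_<ᵣ_within_ : ℚ → Qβ → ℕ × ℕ → Set
q <ᵣ (a , b) within (L , S) = Positive L S (a ℚ.- q , b)

_<ₗ_within_ : Qβ → ℚ → ℕ × ℕ → Set
(a , b) <ₗ q within (L , S) = Positive L S (q ℚ.- a , ℚ.- b)

-- Density in [0,1]² of the two-dimensional sequence (ξ_{L₁,S₁}^n, ξ_{L₂,S₂}^n):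
-- every nonempty open box with rational corners inside [0,1]² contains a point.

Dense2 : ℕ → ℕ → ℕ → ℕ → Set
Dense2 L₁ S₁ L₂ S₂ =
  ∀ (p₁ q₁ p₂ q₂ : ℚ) →
  0ℚ ≤ p₁ → p₁ < q₁ → q₁ ≤ ℚ.1ℚ →
  0ℚ ≤ p₂ → p₂ < q₂ → q₂ ≤ ℚ.1ℚ →
  ∃[ n ] ( (p₁ <ᵣ ξ L₁ S₁ n within (L₁ , S₁))
         × (ξ L₁ S₁ n <ₗ q₁ within (L₁ , S₁))
         × (p₂ <ᵣ ξ L₂ S₂ n within (L₂ , S₂))
         × (ξ L₂ S₂ n <ₗ q₂ within (L₂ , S₂)) )

module Submission where

-- The first level of an LS-sequence splits [0,1) into L + S intervals
-- I_0, ..., I_{L+S-1}; I_b starts at ξ^b and ends at digit 0 b.  Each N has a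
-- first digit b with ξ^N ∈ I_b, and N ≡ b (mod d): writing N = t_n + η l_n + r
-- only adds multiples of t_n and l_n (n ≥ 1), which d divides because d
-- divides L and S.  Now ξ₁^N < 1/(L₁+S₁) ≤ β₁ forces b = 0, so d ∣ N, and
-- ξ₂^N > 1 - 1/(L₂+S₂)² ≥ 1 - β₂² forces b = L₂ + S₂ - 1, so d ∣ N + 1.
-- Hence d ∣ 1, and the box (0, 1/(L₁+S₁)) × (1 - 1/(L₂+S₂)², 1) is empty.

open import Defs
open import Data.Nat using (ℕ)


module Embedding where
  open import Data.Nat as ℕ using (ℕ; suc)
  import Data.Nat.Properties as ℕP
  open import Data.Integer as ℤ using (+_)
  import Data.Integer.Properties as ℤP
  open import Data.Rational as ℚ using (ℚ; 0ℚ; 1ℚ; _<_; _≤_)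
  import Data.Rational.Properties as ℚP
  import Data.Rational.Unnormalised as ℚᵘ
  import Data.Rational.Unnormalised.Properties as ℚᵘP
  open import Data.Nat.Coprimality using (1-coprimeTo; sym)
  open import Relation.Binary.PropositionalEquality using (_≡_; refl; cong; cong₂)

  -- The embedding ℕ → ℚ of Defs is a semiring homomorphism.  It factors
  -- through the unnormalised rationals, where n becomes n/1 on the nose.
  ℕtoℚ-toℚᵘ : ∀ n → ℚ.toℚᵘ (ℕtoℚ n) ≡ ℚᵘ.mkℚᵘ (+ n) 0
  ℕtoℚ-toℚᵘ n rewrite ℚP.normalize-coprime (sym (1-coprimeTo n)) = refl

  ℕtoℚ-+ : ∀ m n → ℕtoℚ (m ℕ.+ n) ≡ ℕtoℚ m ℚ.+ ℕtoℚ n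
  ℕtoℚ-+ m n = ℚP.toℚᵘ-injective (begin
    ℚ.toℚᵘ (ℕtoℚ (m ℕ.+ n))                    ≈⟨ ℚᵘP.≃-reflexive (ℕtoℚ-toℚᵘ (m ℕ.+ n)) ⟩
    ℚᵘ.mkℚᵘ (+ (m ℕ.+ n)) 0                     ≈⟨ ℚᵘ.*≡* numerators ⟩
    ℚᵘ.mkℚᵘ (+ m) 0 ℚᵘ.+ ℚᵘ.mkℚᵘ (+ n) 0        ≈⟨ ℚᵘP.≃-sym (ℚᵘP.≃-reflexive (cong₂ ℚᵘ._+_ (ℕtoℚ-toℚᵘ m) (ℕtoℚ-toℚᵘ n))) ⟩
    ℚ.toℚᵘ (ℕtoℚ m) ℚᵘ.+ ℚ.toℚᵘ (ℕtoℚ n)      ≈⟨ ℚᵘP.≃-sym (ℚP.toℚᵘ-homo-+ (ℕtoℚ m) (ℕtoℚ n)) ⟩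
    ℚ.toℚᵘ (ℕtoℚ m ℚ.+ ℕtoℚ n)                ∎)
    where
    open import Relation.Binary.Reasoning.Setoid ℚᵘP.≃-setoid
    numerators : + (m ℕ.+ n) ℤ.* + 1 ≡ (+ m ℤ.* + 1 ℤ.+ + n ℤ.* + 1) ℤ.* + 1
    numerators rewrite ℤP.*-identityʳ (+ m) | ℤP.*-identityʳ (+ n) | ℤP.*-identityʳ (+ m ℤ.+ + n) = refl

  ℕtoℚ-* : ∀ m n → ℕtoℚ (m ℕ.* n) ≡ ℕtoℚ m ℚ.* ℕtoℚ n
  ℕtoℚ-* m n = ℚP.toℚᵘ-injective (begin
    ℚ.toℚᵘ (ℕtoℚ (m ℕ.* n))                    ≈⟨ ℚᵘP.≃-reflexive (ℕtoℚ-toℚᵘ (m ℕ.* n)) ⟩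
    ℚᵘ.mkℚᵘ (+ (m ℕ.* n)) 0                     ≈⟨ ℚᵘ.*≡* (cong (ℤ._* + 1) (ℤP.pos-* m n)) ⟩
    ℚᵘ.mkℚᵘ (+ m) 0 ℚᵘ.* ℚᵘ.mkℚᵘ (+ n) 0        ≈⟨ ℚᵘP.≃-sym (ℚᵘP.≃-reflexive (cong₂ ℚᵘ._*_ (ℕtoℚ-toℚᵘ m) (ℕtoℚ-toℚᵘ n))) ⟩
    ℚ.toℚᵘ (ℕtoℚ m) ℚᵘ.* ℚ.toℚᵘ (ℕtoℚ n)      ≈⟨ ℚᵘP.≃-sym (ℚP.toℚᵘ-homo-* (ℕtoℚ m) (ℕtoℚ n)) ⟩
    ℚ.toℚᵘ (ℕtoℚ m ℚ.* ℕtoℚ n)                ∎)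
    where open import Relation.Binary.Reasoning.Setoid ℚᵘP.≃-setoid

  inv : ℕ → ℚ
  inv k = (+ 1) ℚ./ suc k

  ℕtoℚ-*-inv : ∀ k → ℕtoℚ (suc k) ℚ.* inv k ≡ 1ℚ
  ℕtoℚ-*-inv k = ℚP.toℚᵘ-injective (begin
    ℚ.toℚᵘ (ℕtoℚ (suc k) ℚ.* inv k)               ≈⟨ ℚP.toℚᵘ-homo-* (ℕtoℚ (suc k)) (inv k) ⟩
    ℚ.toℚᵘ (ℕtoℚ (suc k)) ℚᵘ.* ℚ.toℚᵘ (inv k)      ≈⟨ ℚᵘP.*-cong (ℚᵘP.≃-reflexive (ℕtoℚ-toℚᵘ (suc k))) (ℚP.toℚᵘ-fromℚᵘ (ℚᵘ.mkℚᵘ (+ 1) k)) ⟩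
    ℚᵘ.mkℚᵘ (+ suc k) 0 ℚᵘ.* ℚᵘ.mkℚᵘ (+ 1) k       ≈⟨ ℚᵘ.*≡* (cong (λ z → + suc z) numerators) ⟩
    ℚ.toℚᵘ 1ℚ                                     ∎)
    where
    open import Relation.Binary.Reasoning.Setoid ℚᵘP.≃-setoid
    numerators : k ℕ.* 1 ℕ.* 1 ≡ k ℕ.+ 0 ℕ.* suc k ℕ.+ 0 ℕ.* suc (k ℕ.+ 0 ℕ.* suc k)
    numerators rewrite ℕP.*-identityʳ k | ℕP.*-identityʳ k | ℕP.+-identityʳ k | ℕP.+-identityʳ k = refl

  ℕtoℚ-nonNeg : ∀ n → 0ℚ ≤ ℕtoℚ n
  ℕtoℚ-nonNeg n = ℚP.nonNegative⁻¹ (ℕtoℚ n) {{ℚP.normalize-nonNeg n 1}}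

  ℕtoℚ-pos : ∀ k → 0ℚ < ℕtoℚ (suc k)
  ℕtoℚ-pos k = ℚP.positive⁻¹ (ℕtoℚ (suc k)) {{ℚP.normalize-pos (suc k) 1}}

  inv-pos : ∀ k → 0ℚ < inv k
  inv-pos k = ℚP.positive⁻¹ (inv k) {{ℚP.normalize-pos 1 (suc k)}}

open Embedding

module Arithmetic where
  open import Data.Nat as ℕ using (ℕ; zero; suc)
  open import Data.Rational as ℚ using (ℚ; 0ℚ; 1ℚ)
  import Data.Rational.Properties as ℚP
  open import Data.Product using (_,_; proj₁; proj₂)
  open import Algebra.Bundles using (CommutativeMonoid)
  open import Algebra.Structures using (IsCommutativeMonoid)
  import Algebra.Solver.CommutativeMonoid
  open import Relation.Binary.PropositionalEquality
    using (_≡_; refl; cong; cong₂; trans; isEquivalence; module ≡-Reasoning)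
    renaming (sym to ≡-sym)
  open import Data.Rational.Solver using (module +-*-Solver)
  open +-*-Solver

  ⊕-isCommutativeMonoid : IsCommutativeMonoid _≡_ _⊕_ zeroβ
  ⊕-isCommutativeMonoid = record
    { isMonoid = record
      { isSemigroup = record
        { isMagma = record { isEquivalence = isEquivalence ; ∙-cong = cong₂ _⊕_ }
        ; assoc = λ x y z → cong₂ _,_ (ℚP.+-assoc (proj₁ x) (proj₁ y) (proj₁ z)) (ℚP.+-assoc (proj₂ x) (proj₂ y) (proj₂ z)) }
      ; identity = (λ x → cong₂ _,_ (ℚP.+-identityˡ (proj₁ x)) (ℚP.+-identityˡ (proj₂ x)))
                 , (λ x → cong₂ _,_ (ℚP.+-identityʳ (proj₁ x)) (ℚP.+-identityʳ (proj₂ x))) }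
    ; comm = λ x y → cong₂ _,_ (ℚP.+-comm (proj₁ x) (proj₁ y)) (ℚP.+-comm (proj₂ x) (proj₂ y)) }

  ⊕-commutativeMonoid : CommutativeMonoid _ _
  ⊕-commutativeMonoid = record { isCommutativeMonoid = ⊕-isCommutativeMonoid }

  open IsCommutativeMonoid ⊕-isCommutativeMonoid public
    using () renaming (assoc to ⊕-assoc; comm to ⊕-comm; identityˡ to ⊕-identityˡ; identityʳ to ⊕-identityʳ)

  open Algebra.Solver.CommutativeMonoid ⊕-commutativeMonoid public
    using (_⊜_) renaming (solve to ⊕-solve; _⊕_ to _⊞_)

  scale-zero : ∀ x → scale 0 x ≡ zeroβ
  scale-zero (a , b) = cong₂ _,_ (ℚP.*-zeroˡ a) (ℚP.*-zeroˡ b)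

  scale-one : ∀ x → scale 1 x ≡ x
  scale-one (a , b) = cong₂ _,_ (ℚP.*-identityˡ a) (ℚP.*-identityˡ b)

  scale-+ : ∀ m n x → scale (m ℕ.+ n) x ≡ scale m x ⊕ scale n x
  scale-+ m n (a , b) rewrite ℕtoℚ-+ m n =
    cong₂ _,_ (ℚP.*-distribʳ-+ a (ℕtoℚ m) (ℕtoℚ n)) (ℚP.*-distribʳ-+ b (ℕtoℚ m) (ℕtoℚ n))

  scale-suc : ∀ k x → scale (suc k) x ≡ x ⊕ scale k x
  scale-suc k x = trans (scale-+ 1 k x) (cong (_⊕ scale k x) (scale-one x))

  scale-⊕ : ∀ k x y → scale k (x ⊕ y) ≡ scale k x ⊕ scale k y
  scale-⊕ k (a , b) (c , d) = cong₂ _,_ (ℚP.*-distribˡ-+ (ℕtoℚ k) a c) (ℚP.*-distribˡ-+ (ℕtoℚ k) b d)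

  scale-* : ∀ m n x → scale m (scale n x) ≡ scale (m ℕ.* n) x
  scale-* m n (a , b) rewrite ℕtoℚ-* m n =
    ≡-sym (cong₂ _,_ (ℚP.*-assoc (ℕtoℚ m) (ℕtoℚ n) a) (ℚP.*-assoc (ℕtoℚ m) (ℕtoℚ n) b))

  mulβ-⊕ : ∀ l0 S x y → mulβ (suc l0) S (x ⊕ y) ≡ mulβ (suc l0) S x ⊕ mulβ (suc l0) S y
  mulβ-⊕ l0 zero (a , b) (c , d) = cong₂ _,_
    (solve 5 (λ a b c d i → (a :+ c :+ (b :+ d) :* i) :* i := (a :+ b :* i) :* i :+ (c :+ d :* i) :* i) refl a b c d (inv l0))
    (≡-sym (ℚP.+-identityʳ 0ℚ))
  mulβ-⊕ l0 (suc s) (a , b) (c , d) = cong₂ _,_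
    (solve 3 (λ b d i → (b :+ d) :* i := b :* i :+ d :* i) refl b d (inv s))
    (solve 6 (λ a b c d i l → a :+ c :- l :* (b :+ d) :* i := (a :- l :* b :* i) :+ (c :- l :* d :* i)) refl a b c d (inv s) (ℕtoℚ (suc l0)))

  mulβ-scale : ∀ l0 S k x → mulβ (suc l0) S (scale k x) ≡ scale k (mulβ (suc l0) S x)
  mulβ-scale l0 zero k (a , b) = cong₂ _,_
    (solve 4 (λ k a b i → (k :* a :+ (k :* b) :* i) :* i := k :* ((a :+ b :* i) :* i)) refl (ℕtoℚ k) a b (inv l0))
    (≡-sym (ℚP.*-zeroʳ (ℕtoℚ k)))
  mulβ-scale l0 (suc s) k (a , b) = cong₂ _,_
    (solve 3 (λ k b i → (k :* b) :* i := k :* (b :* i)) refl (ℕtoℚ k) b (inv s))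
    (solve 5 (λ k a b i l → k :* a :- l :* (k :* b) :* i := k :* (a :- l :* b :* i)) refl (ℕtoℚ k) a b (inv s) (ℕtoℚ (suc l0)))

  -- Eliminating a factor u = 1 from a polynomial identity: the ring solver
  -- proves  f = g + (u - 1) h  and the hypothesis u = 1 finishes.
  unit-elim : ∀ {u} f g h → u ≡ 1ℚ → f ≡ g ℚ.+ (u ℚ.- 1ℚ) ℚ.* h → f ≡ g
  unit-elim f g h refl f≡ = trans f≡ (solve 2 (λ g h → g :+ (con 1ℚ :- con 1ℚ) :* h := g) refl g h)

  mulβ-zero : ∀ l0 S → mulβ (suc l0) S zeroβ ≡ zeroβ
  mulβ-zero l0 S = begin
    mulβ (suc l0) S zeroβ            ≡⟨ cong (mulβ (suc l0) S) (≡-sym (scale-zero zeroβ)) ⟩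
    mulβ (suc l0) S (scale 0 zeroβ)  ≡⟨ mulβ-scale l0 S 0 zeroβ ⟩
    scale 0 (mulβ (suc l0) S zeroβ)  ≡⟨ scale-zero (mulβ (suc l0) S zeroβ) ⟩
    zeroβ                            ∎
    where open ≡-Reasoning

  -- The defining relation L β + S β² = 1, in the form  x = L (β x) + S (β² x).
  -- For S = 0 it holds on the rationals (second component 0), which
  -- contain all powers of β = 1/L.
  mulβ-relation : ∀ l0 s x → let β = mulβ (suc l0) (suc s) in
                  x ≡ scale (suc l0) (β x) ⊕ scale (suc s) (β (β x))
  mulβ-relation l0 s (a , b) = cong₂ _,_
    (≡-sym (unit-elim _ a (a ℚ.- L ℚ.* b ℚ.* i) (ℕtoℚ-*-inv s)
      (solve 5 (λ a b i L S → L :* (b :* i) :+ S :* ((a :- L :* b :* i) :* i)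
                              := a :+ (S :* i :- con 1ℚ) :* (a :- L :* b :* i)) refl a b i L Sq)))
    (≡-sym (unit-elim _ b (b ℚ.- L ℚ.* a ℚ.+ L ℚ.* L ℚ.* b ℚ.* i) (ℕtoℚ-*-inv s)
      (solve 5 (λ a b i L S → L :* (a :- L :* b :* i) :+ S :* (b :* i :- L :* (a :- L :* b :* i) :* i)
                              := b :+ (S :* i :- con 1ℚ) :* (b :- L :* a :+ L :* L :* b :* i)) refl a b i L Sq)))
    where
    i L Sq : ℚ
    i = inv s
    L = ℕtoℚ (suc l0)
    Sq = ℕtoℚ (suc s)

  mulβ-relation₀ : ∀ l0 a → let β = mulβ (suc l0) 0 in
                   (a , 0ℚ) ≡ scale (suc l0) (β (a , 0ℚ)) ⊕ scale 0 (β (β (a , 0ℚ)))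
  mulβ-relation₀ l0 a = cong₂ _,_
    (≡-sym (unit-elim _ a a (ℕtoℚ-*-inv l0)
      (solve 4 (λ a i L c → L :* ((a :+ con 0ℚ :* i) :* i) :+ con 0ℚ :* c := a :+ (L :* i :- con 1ℚ) :* a)
             refl a (inv l0) (ℕtoℚ (suc l0)) (proj₁ (mulβ (suc l0) 0 (mulβ (suc l0) 0 (a , 0ℚ)))))))
    (≡-sym (solve 1 (λ L → L :* con 0ℚ :+ con 0ℚ :* con 0ℚ := con 0ℚ) refl (ℕtoℚ (suc l0))))

  powβ-relation : ∀ l0 S j → let P = powβ (suc l0) S in
                  P j ≡ scale (suc l0) (P (suc j)) ⊕ scale S (P (suc (suc j)))
  powβ-relation l0 (suc s) j     = mulβ-relation l0 s (powβ (suc l0) (suc s) j)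
  powβ-relation l0 zero    zero    = mulβ-relation₀ l0 1ℚ
  powβ-relation l0 zero    (suc j) = mulβ-relation₀ l0 (proj₁ (powβ (suc l0) zero (suc j)))

open Arithmetic

module RationalOrder where
  open import Data.Nat using (suc)
  open import Data.Rational as ℚ using (ℚ; 0ℚ; 1ℚ; _<_; _≤_)
  import Data.Rational.Properties as ℚP
  open import Data.Product using (_×_; _,_)
  open import Data.Sum using (_⊎_; inj₁; inj₂)
  open import Data.Empty using (⊥; ⊥-elim)
  open import Relation.Nullary using (yes; no)
  open import Relation.Binary.PropositionalEquality
    using (_≡_; refl; cong; trans; subst; subst₂)
    renaming (sym to ≡-sym)
  open import Data.Rational.Solver using (module +-*-Solver)
  open +-*-Solver

  *-nonNeg : ∀ {p q} → 0ℚ ≤ p → 0ℚ ≤ q → 0ℚ ≤ p ℚ.* q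
  *-nonNeg {p} {q} 0≤p 0≤q =
    ℚP.nonNegative⁻¹ _ {{ℚP.nonNeg*nonNeg⇒nonNeg p {{ℚ.nonNegative 0≤p}} q {{ℚ.nonNegative 0≤q}}}}

  *-pos : ∀ {p q} → 0ℚ < p → 0ℚ < q → 0ℚ < p ℚ.* q
  *-pos {p} {q} 0<p 0<q = ℚP.positive⁻¹ _ {{ℚP.pos*pos⇒pos p {{ℚ.positive 0<p}} q {{ℚ.positive 0<q}}}}

  *-monoˡ-≤ : ∀ {r p q} → 0ℚ ≤ r → p ≤ q → r ℚ.* p ≤ r ℚ.* q
  *-monoˡ-≤ {r} 0≤r = ℚP.*-monoˡ-≤-nonNeg r {{ℚ.nonNegative 0≤r}}

  *-monoʳ-≤ : ∀ {r p q} → 0ℚ ≤ r → p ≤ q → p ℚ.* r ≤ q ℚ.* r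
  *-monoʳ-≤ {r} 0≤r = ℚP.*-monoʳ-≤-nonNeg r {{ℚ.nonNegative 0≤r}}

  *-monoˡ-< : ∀ {r p q} → 0ℚ < r → p < q → r ℚ.* p < r ℚ.* q
  *-monoˡ-< {r} 0<r = ℚP.*-monoʳ-<-pos r {{ℚ.positive 0<r}}

  square-nonNeg : ∀ p → 0ℚ ≤ p ℚ.* p
  square-nonNeg p with ℚP.≤-total 0ℚ p
  ... | inj₁ 0≤p = *-nonNeg 0≤p 0≤p
  ... | inj₂ p≤0 = ℚP.nonNegative⁻¹ _ {{ℚP.nonPos*nonPos⇒nonPos p {{ℚ.nonPositive p≤0}} p {{ℚ.nonPositive p≤0}}}}

  square-pos : ∀ {p} → p < 0ℚ → 0ℚ < p ℚ.* p
  square-pos {p} p<0 = ℚP.positive⁻¹ _ {{ℚP.neg*neg⇒pos p {{ℚ.negative p<0}} p {{ℚ.negative p<0}}}}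

  *-pos-neg : ∀ {p q} → 0ℚ < p → q < 0ℚ → p ℚ.* q < 0ℚ
  *-pos-neg {p} {q} 0<p q<0 = ℚP.negative⁻¹ _ {{ℚP.pos*neg⇒neg p {{ℚ.positive 0<p}} q {{ℚ.negative q<0}}}}

  square-zero : ∀ {p} → 0ℚ ≤ p → p ≤ 0ℚ → p ℚ.* p ≡ 0ℚ
  square-zero 0≤p p≤0 rewrite ℚP.≤-antisym p≤0 0≤p = refl

  square-mono-≤ : ∀ {p q} → 0ℚ ≤ p → p ≤ q → p ℚ.* p ≤ q ℚ.* q
  square-mono-≤ 0≤p p≤q = ℚP.≤-trans (*-monoˡ-≤ 0≤p p≤q) (*-monoʳ-≤ (ℚP.≤-trans 0≤p p≤q) p≤q)

  square-mono-< : ∀ {p q} → 0ℚ ≤ p → p < q → p ℚ.* p < q ℚ.* q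
  square-mono-< {p} {q} 0≤p p<q = ℚP.≤-<-trans (*-monoˡ-≤ 0≤p (ℚP.<⇒≤ p<q))
    (ℚP.*-monoˡ-<-pos q {{ℚ.positive (ℚP.≤-<-trans 0≤p p<q)}} p<q)

  square-cancel-≤ : ∀ {p q} → 0ℚ ≤ p → 0ℚ ≤ q → p ℚ.* p ≤ q ℚ.* q → p ≤ q
  square-cancel-≤ {p} {q} 0≤p 0≤q p²≤q² with p ℚP.≤? q
  ... | yes p≤q = p≤q
  ... | no  p≰q = ⊥-elim (ℚP.<-irrefl refl (ℚP.<-≤-trans (square-mono-< 0≤q (ℚP.≰⇒> p≰q)) p²≤q²))

  ≤⇒0≤- : ∀ {p q} → p ≤ q → 0ℚ ≤ q ℚ.- p
  ≤⇒0≤- {p} {q} p≤q = subst (_≤ q ℚ.- p) (ℚP.+-inverseʳ p) (ℚP.+-monoˡ-≤ (ℚ.- p) p≤q)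

  0≤-⇒≤ : ∀ {p q} → 0ℚ ≤ q ℚ.- p → p ≤ q
  0≤-⇒≤ {p} {q} 0≤q-p = subst₂ _≤_ (ℚP.+-identityˡ p) (solve 2 (λ p q → q :- p :+ p := q) refl p q)
    (ℚP.+-monoˡ-≤ p 0≤q-p)

  neg-involutive : ∀ p → ℚ.- (ℚ.- p) ≡ p
  neg-involutive = solve 1 (λ p → :- (:- p) := p) refl

  ≤-+-nonNeg : ∀ {k} p → 0ℚ ≤ k → p ≤ k ℚ.+ p
  ≤-+-nonNeg {k} p 0≤k = subst (_≤ k ℚ.+ p) (ℚP.+-identityˡ p) (ℚP.+-monoˡ-≤ p 0≤k)

  neg-square : ∀ p → (ℚ.- p) ℚ.* (ℚ.- p) ≡ p ℚ.* p
  neg-square = solve 1 (λ p → (:- p) :* (:- p) := p :* p) refl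

  0<-⇒<0 : ∀ {p} → 0ℚ < ℚ.- p → p < 0ℚ
  0<-⇒<0 {p} 0<-p = subst (_< 0ℚ) (neg-involutive p) (ℚP.neg-antimono-< 0<-p)

  0≤-⇒≤0 : ∀ {p} → 0ℚ ≤ ℚ.- p → p ≤ 0ℚ
  0≤-⇒≤0 {p} 0≤-p = subst (_≤ 0ℚ) (neg-involutive p) (ℚP.neg-antimono-≤ 0≤-p)

  scale-square : ∀ w u → w ℚ.* w ℚ.* (u ℚ.* u) ≡ w ℚ.* u ℚ.* (w ℚ.* u)
  scale-square = solve 2 (λ w u → w :* w :* (u :* u) := w :* u :* (w :* u)) refl

  scale-square-D : ∀ w v D → w ℚ.* w ℚ.* (v ℚ.* v ℚ.* D) ≡ w ℚ.* v ℚ.* (w ℚ.* v) ℚ.* D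
  scale-square-D = solve 3 (λ w v D → w :* w :* (v :* v :* D) := w :* v :* (w :* v) :* D) refl

  -- u + v √D ≥ 0  (for D ≥ 0), decided by squaring like PosSqrt in Defs:
  -- either u ≥ 0 dominates v √D in absolute value, or v √D ≥ 0 dominates u.
  NonNegSqrt : ℚ → ℚ → ℚ → Set
  NonNegSqrt u v D = (0ℚ ≤ u × v ℚ.* v ℚ.* D ≤ u ℚ.* u) ⊎ (0ℚ ≤ v × u ℚ.* u ≤ v ℚ.* v ℚ.* D)

  nonNegSqrt-+ : ∀ {k u v D} → 0ℚ ≤ k → NonNegSqrt u v D → NonNegSqrt (k ℚ.+ u) v D
  nonNegSqrt-+ {k} {u} {v} {D} 0≤k (inj₁ (0≤u , v²D≤u²)) =
    inj₁ (ℚP.≤-trans 0≤u (≤-+-nonNeg u 0≤k) , ℚP.≤-trans v²D≤u² (square-mono-≤ 0≤u (≤-+-nonNeg u 0≤k)))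
  nonNegSqrt-+ {k} {u} {v} {D} 0≤k (inj₂ (0≤v , u²≤v²D)) with 0ℚ ℚP.≤? k ℚ.+ u
  ... | yes 0≤k+u with (k ℚ.+ u) ℚ.* (k ℚ.+ u) ℚP.≤? v ℚ.* v ℚ.* D
  ...   | yes dominated = inj₂ (0≤v , dominated)
  ...   | no  dominates = inj₁ (0≤k+u , ℚP.<⇒≤ (ℚP.≰⇒> dominates))
  nonNegSqrt-+ {k} {u} {v} {D} 0≤k (inj₂ (0≤v , u²≤v²D)) | no k+u≱0 =
    inj₂ (0≤v , ℚP.≤-trans [k+u]²≤u² u²≤v²D)
    where
    -- u ≤ k + u < 0, so |k + u| ≤ |u|
    [k+u]²≤u² : (k ℚ.+ u) ℚ.* (k ℚ.+ u) ≤ u ℚ.* u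
    [k+u]²≤u² = subst₂ _≤_ (neg-square (k ℚ.+ u)) (neg-square u)
      (square-mono-≤ (ℚP.neg-antimono-≤ (ℚP.<⇒≤ (ℚP.≰⇒> k+u≱0))) (ℚP.neg-antimono-≤ (≤-+-nonNeg u 0≤k)))

  nonNegSqrt-scale : ∀ {w u v D} → 0ℚ < w → NonNegSqrt u v D → NonNegSqrt (w ℚ.* u) (w ℚ.* v) D
  nonNegSqrt-scale {w} {u} {v} {D} 0<w (inj₁ (0≤u , v²D≤u²)) =
    inj₁ (*-nonNeg (ℚP.<⇒≤ 0<w) 0≤u , subst₂ _≤_ (scale-square-D w v D) (scale-square w u) (*-monoˡ-≤ (square-nonNeg w) v²D≤u²))
  nonNegSqrt-scale {w} {u} {v} {D} 0<w (inj₂ (0≤v , u²≤v²D)) =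
    inj₂ (*-nonNeg (ℚP.<⇒≤ 0<w) 0≤v , subst₂ _≤_ (scale-square w u) (scale-square-D w v D) (*-monoˡ-≤ (square-nonNeg w) u²≤v²D))

  -- multiplying by √D - L ≥ 0 (where 0 ≤ L, L² ≤ D):
  -- (u + v √D)(√D - L) = (v D - u L) + (u - v L) √D
  nonNegSqrt-conj : ∀ {L D u v} → 0ℚ ≤ L → L ℚ.* L ≤ D → NonNegSqrt u v D →
                    NonNegSqrt (v ℚ.* D ℚ.- u ℚ.* L) (u ℚ.- v ℚ.* L) D
  nonNegSqrt-conj {L} {D} {u} {v} 0≤L L²≤D (inj₁ (0≤u , v²D≤u²)) = inj₂ (0≤u-vL , squares)
    where
    0≤u-vL : 0ℚ ≤ u ℚ.- v ℚ.* L
    0≤u-vL with ℚP.≤-total v 0ℚ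
    ... | inj₁ v≤0 = ≤⇒0≤- (ℚP.≤-trans (subst (v ℚ.* L ≤_) (ℚP.*-zeroˡ L) (*-monoʳ-≤ 0≤L v≤0)) 0≤u)
    ... | inj₂ 0≤v = ≤⇒0≤- (square-cancel-≤ (*-nonNeg 0≤v 0≤L) 0≤u
            (subst (_≤ u ℚ.* u) (solve 2 (λ v L → v :* v :* (L :* L) := v :* L :* (v :* L)) refl v L)
               (ℚP.≤-trans (*-monoˡ-≤ (square-nonNeg v) L²≤D) v²D≤u²)))
    squares : (v ℚ.* D ℚ.- u ℚ.* L) ℚ.* (v ℚ.* D ℚ.- u ℚ.* L) ≤ (u ℚ.- v ℚ.* L) ℚ.* (u ℚ.- v ℚ.* L) ℚ.* D
    squares = 0≤-⇒≤ (subst (0ℚ ≤_)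
      (solve 4 (λ L D u v → (D :- L :* L) :* (u :* u :- v :* v :* D)
                            := (u :- v :* L) :* (u :- v :* L) :* D :- (v :* D :- u :* L) :* (v :* D :- u :* L)) refl L D u v)
      (*-nonNeg (≤⇒0≤- L²≤D) (≤⇒0≤- v²D≤u²)))
  nonNegSqrt-conj {L} {D} {u} {v} 0≤L L²≤D (inj₂ (0≤v , u²≤v²D)) = inj₁ (0≤vD-uL , squares)
    where
    0≤D : 0ℚ ≤ D
    0≤D = ℚP.≤-trans (square-nonNeg L) L²≤D
    0≤vD-uL : 0ℚ ≤ v ℚ.* D ℚ.- u ℚ.* L
    0≤vD-uL with ℚP.≤-total u 0ℚ
    ... | inj₁ u≤0 = ≤⇒0≤- (ℚP.≤-trans (subst (u ℚ.* L ≤_) (ℚP.*-zeroˡ L) (*-monoʳ-≤ 0≤L u≤0)) (*-nonNeg 0≤v 0≤D))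
    ... | inj₂ 0≤u = ≤⇒0≤- (square-cancel-≤ (*-nonNeg 0≤u 0≤L) (*-nonNeg 0≤v 0≤D)
            (subst₂ _≤_ (solve 2 (λ u L → u :* u :* (L :* L) := u :* L :* (u :* L)) refl u L)
                        (solve 2 (λ v D → v :* v :* D :* D := v :* D :* (v :* D)) refl v D)
               (ℚP.≤-trans (*-monoʳ-≤ (square-nonNeg L) u²≤v²D) (*-monoˡ-≤ (*-nonNeg (square-nonNeg v) 0≤D) L²≤D))))
    squares : (u ℚ.- v ℚ.* L) ℚ.* (u ℚ.- v ℚ.* L) ℚ.* D ≤ (v ℚ.* D ℚ.- u ℚ.* L) ℚ.* (v ℚ.* D ℚ.- u ℚ.* L)
    squares = 0≤-⇒≤ (subst (0ℚ ≤_)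
      (solve 4 (λ L D u v → (D :- L :* L) :* (v :* v :* D :- u :* u)
                            := (v :* D :- u :* L) :* (v :* D :- u :* L) :- (u :- v :* L) :* (u :- v :* L) :* D) refl L D u v)
      (*-nonNeg (≤⇒0≤- L²≤D) (≤⇒0≤- u²≤v²D)))

  nonNegSqrt-¬posSqrt-neg : ∀ {u v Dn} → 0ℚ < ℕtoℚ Dn → NonNegSqrt u v (ℕtoℚ Dn) → PosSqrt (ℚ.- u) (ℚ.- v) Dn → ⊥
  nonNegSqrt-¬posSqrt-neg {u} {v} {Dn} 0<D = absurd
    where
    D : ℚ
    D = ℕtoℚ Dn
    <-irrefl′ : ∀ {p} → p < p → ⊥
    <-irrefl′ = ℚP.<-irrefl refl
    v²D-neg : (ℚ.- v) ℚ.* (ℚ.- v) ℚ.* D ≡ v ℚ.* v ℚ.* D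
    v²D-neg = cong (ℚ._* D) (neg-square v)
    absurd : NonNegSqrt u v D → PosSqrt (ℚ.- u) (ℚ.- v) Dn → ⊥
    -- u ≥ 0 and -u ≥ 0 force u = 0; then -u > 0 or v² D ≤ 0 < v² D
    absurd (inj₁ (0≤u , _)) (inj₁ (_ , _ , inj₁ 0<-u)) = <-irrefl′ (ℚP.<-≤-trans 0<-u (ℚP.neg-antimono-≤ 0≤u))
    absurd (inj₁ (0≤u , v²D≤u²)) (inj₁ (-u≥0 , _ , inj₂ 0<-v)) = <-irrefl′ (
      ℚP.<-≤-trans (*-pos (square-pos (0<-⇒<0 0<-v)) 0<D) (subst (v ℚ.* v ℚ.* D ≤_) (square-zero 0≤u (0≤-⇒≤0 -u≥0)) v²D≤u²))
    absurd (inj₂ (0≤v , _)) (inj₁ (_ , _ , inj₂ 0<-v)) = <-irrefl′ (ℚP.<-≤-trans 0<-v (ℚP.neg-antimono-≤ 0≤v))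
    absurd (inj₂ (0≤v , u²≤v²D)) (inj₁ (_ , -v≥0 , inj₁ 0<-u)) = <-irrefl′ (
      ℚP.<-≤-trans (square-pos (0<-⇒<0 0<-u))
        (subst (u ℚ.* u ≤_) (trans (cong (ℚ._* D) (square-zero 0≤v (0≤-⇒≤0 -v≥0))) (ℚP.*-zeroˡ D)) u²≤v²D))
    absurd (inj₁ (0≤u , _)) (inj₂ (inj₁ (-u≥0 , _ , v²D<u²))) = <-irrefl′ (
      ℚP.≤-<-trans (*-nonNeg (square-nonNeg (ℚ.- v)) (ℚP.<⇒≤ 0<D))
        (subst ((ℚ.- v) ℚ.* (ℚ.- v) ℚ.* D <_) (trans (neg-square u) (square-zero 0≤u (0≤-⇒≤0 -u≥0))) v²D<u²))
    absurd (inj₂ (_ , u²≤v²D)) (inj₂ (inj₁ (_ , _ , v²D<u²))) = <-irrefl′ (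
      ℚP.<-≤-trans (subst₂ _<_ v²D-neg (neg-square u) v²D<u²) u²≤v²D)
    absurd (inj₁ (_ , v²D≤u²)) (inj₂ (inj₂ (_ , _ , u²<v²D))) = <-irrefl′ (
      ℚP.<-≤-trans (subst₂ _<_ (neg-square u) v²D-neg u²<v²D) v²D≤u²)
    absurd (inj₂ (0≤v , _)) (inj₂ (inj₂ (_ , 0<-v , _))) = <-irrefl′ (ℚP.<-≤-trans 0<-v (ℚP.neg-antimono-≤ 0≤v))

  posSqrt-scale : ∀ {w u v Dn} → 0ℚ < w → PosSqrt u v Dn → PosSqrt (w ℚ.* u) (w ℚ.* v) Dn
  posSqrt-scale {w} 0<w (inj₁ (0≤u , 0≤v , inj₁ 0<u)) = inj₁ (*-nonNeg (ℚP.<⇒≤ 0<w) 0≤u , *-nonNeg (ℚP.<⇒≤ 0<w) 0≤v , inj₁ (*-pos 0<w 0<u))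
  posSqrt-scale {w} 0<w (inj₁ (0≤u , 0≤v , inj₂ 0<v)) = inj₁ (*-nonNeg (ℚP.<⇒≤ 0<w) 0≤u , *-nonNeg (ℚP.<⇒≤ 0<w) 0≤v , inj₂ (*-pos 0<w 0<v))
  posSqrt-scale {w} {u} {v} {Dn} 0<w (inj₂ (inj₁ (0≤u , v<0 , v²D<u²))) =
    inj₂ (inj₁ (*-nonNeg (ℚP.<⇒≤ 0<w) 0≤u , *-pos-neg 0<w v<0 ,
      subst₂ _<_ (scale-square-D w v (ℕtoℚ Dn)) (scale-square w u) (*-monoˡ-< (*-pos 0<w 0<w) v²D<u²)))
  posSqrt-scale {w} {u} {v} {Dn} 0<w (inj₂ (inj₂ (u<0 , 0<v , u²<v²D))) =
    inj₂ (inj₂ (*-pos-neg 0<w u<0 , *-pos 0<w 0<v ,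
      subst₂ _<_ (scale-square w u) (scale-square-D w v (ℕtoℚ Dn)) (*-monoˡ-< (*-pos 0<w 0<w) u²<v²D)))

  inv-≤-1 : ∀ k → inv k ≤ 1ℚ
  inv-≤-1 k = subst₂ _≤_ (ℚP.*-identityˡ (inv k)) (ℕtoℚ-*-inv k) (*-monoʳ-≤ (ℚP.<⇒≤ (inv-pos k)) 1≤k+1)
    where
    1≤k+1 : 1ℚ ≤ ℕtoℚ (suc k)
    1≤k+1 = subst₂ _≤_ (ℚP.+-identityʳ 1ℚ) (≡-sym (ℕtoℚ-+ 1 k)) (ℚP.+-monoʳ-≤ 1ℚ (ℕtoℚ-nonNeg k))

  1-inv-nonNeg : ∀ k → 0ℚ ≤ 1ℚ ℚ.- inv k
  1-inv-nonNeg k = ≤⇒0≤- (inv-≤-1 k)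

  1-inv-<-1 : ∀ k → 1ℚ ℚ.- inv k < 1ℚ
  1-inv-<-1 k = subst (1ℚ ℚ.- inv k <_) (ℚP.+-identityʳ 1ℚ) (ℚP.+-monoʳ-< 1ℚ (ℚP.neg-antimono-< (inv-pos k)))

open RationalOrder

module Nonnegativity where
  open import Data.Nat as ℕ using (ℕ; zero; suc)
  open import Data.Rational as ℚ using (ℚ; 0ℚ; 1ℚ; _<_; _≤_)
  import Data.Rational.Properties as ℚP
  open import Data.Product using (_,_)
  open import Data.Empty using (⊥)
  open import Data.Sum using (inj₁)
  open import Relation.Binary.PropositionalEquality
    using (_≡_; refl; cong; cong₂; trans; subst; subst₂)
    renaming (sym to ≡-sym)
  open import Data.Rational.Solver using (module +-*-Solver)
  open +-*-Solver

  Nonneg : ℕ → ℕ → Qβ → Set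
  Nonneg L zero    (c , b) = 0ℚ ≤ c ℚ.+ divℕ b L
  Nonneg L (suc s) (c , b) =
    NonNegSqrt (ℕtoℚ (2 ℕ.* suc s) ℚ.* c ℚ.- ℕtoℚ L ℚ.* b) b (ℕtoℚ (L ℕ.* L ℕ.+ 4 ℕ.* suc s))

  nonneg-zero : ∀ l0 S → Nonneg (suc l0) S zeroβ
  nonneg-zero l0 zero = ℚP.≤-reflexive (solve 1 (λ i → con 0ℚ := con 0ℚ :+ con 0ℚ :* i) refl (inv l0))
  nonneg-zero l0 (suc s) = inj₁ (ℚP.≤-reflexive (≡-sym u≡0) ,
    ℚP.≤-reflexive (trans (ℚP.*-zeroˡ D) (≡-sym (cong (λ u → u ℚ.* u) u≡0))))
    where
    D : ℚ
    D = ℕtoℚ (suc l0 ℕ.* suc l0 ℕ.+ 4 ℕ.* suc s)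
    u≡0 : ℕtoℚ (2 ℕ.* suc s) ℚ.* 0ℚ ℚ.- ℕtoℚ (suc l0) ℚ.* 0ℚ ≡ 0ℚ
    u≡0 = solve 2 (λ a b → a :* con 0ℚ :- b :* con 0ℚ := con 0ℚ) refl (ℕtoℚ (2 ℕ.* suc s)) (ℕtoℚ (suc l0))

  nonneg-+const : ∀ l0 S {c} x → 0ℚ ≤ c → Nonneg (suc l0) S x → Nonneg (suc l0) S ((c , 0ℚ) ⊕ x)
  nonneg-+const l0 zero {c} (a , b) 0≤c 0≤x =
    subst (0ℚ ≤_) (solve 4 (λ c a b i → c :+ (a :+ b :* i) := c :+ a :+ (con 0ℚ :+ b) :* i) refl c a b (inv l0))
      (ℚP.nonNegative⁻¹ _ {{ℚP.nonNeg+nonNeg⇒nonNeg c {{ℚ.nonNegative 0≤c}} _ {{ℚ.nonNegative 0≤x}}}})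
  nonneg-+const l0 (suc s) {c} (a , b) 0≤c 0≤x =
    subst₂ (λ u v → NonNegSqrt u v _)
      (solve 5 (λ t c a L b → t :* c :+ (t :* a :- L :* b) := t :* (c :+ a) :- L :* (con 0ℚ :+ b)) refl
         (ℕtoℚ (2 ℕ.* suc s)) c a (ℕtoℚ (suc l0)) b)
      (≡-sym (ℚP.+-identityˡ b))
      (nonNegSqrt-+ (*-nonNeg (ℕtoℚ-nonNeg (2 ℕ.* suc s)) 0≤c) 0≤x)

  -- Multiplication by β > 0 preserves Nonneg.  For S > 0, with D = L² + 4S,
  -- 2S(c + bβ) = u + b√D where u = 2Sc - bL, and β = (√D - L)/(2S).
  nonneg-β : ∀ l0 S x → Nonneg (suc l0) S x → Nonneg (suc l0) S (mulβ (suc l0) S x)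
  nonneg-β l0 zero (a , b) 0≤x =
    subst (0ℚ ≤_) (solve 2 (λ t i → t :* i := t :* i :+ con 0ℚ :* i) refl (a ℚ.+ b ℚ.* inv l0) (inv l0))
      (*-nonNeg 0≤x (ℚP.<⇒≤ (inv-pos l0)))
  nonneg-β l0 (suc s) (a , b) 0≤x =
    subst₂ (λ u v → NonNegSqrt u v D) (first-coefficient D≡ twoS≡) (second-coefficient twoS≡)
      (nonNegSqrt-scale (*-pos half-pos (inv-pos s)) (nonNegSqrt-conj (ℕtoℚ-nonNeg (suc l0)) L²≤D 0≤x))
    where
    Lq Sq i D twoS : ℚ
    Lq = ℕtoℚ (suc l0)
    Sq = ℕtoℚ (suc s)
    i  = inv s
    D  = ℕtoℚ (suc l0 ℕ.* suc l0 ℕ.+ 4 ℕ.* suc s)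
    twoS = ℕtoℚ (2 ℕ.* suc s)
    half : ℚ
    half = inv 1
    half-pos : 0ℚ < half
    half-pos = inv-pos 1
    D≡ : D ≡ Lq ℚ.* Lq ℚ.+ ℕtoℚ 4 ℚ.* Sq
    D≡ = trans (ℕtoℚ-+ (suc l0 ℕ.* suc l0) (4 ℕ.* suc s)) (cong₂ ℚ._+_ (ℕtoℚ-* (suc l0) (suc l0)) (ℕtoℚ-* 4 (suc s)))
    twoS≡ : twoS ≡ ℕtoℚ 2 ℚ.* Sq
    twoS≡ = ℕtoℚ-* 2 (suc s)
    L²≤D : Lq ℚ.* Lq ≤ D
    L²≤D = subst₂ _≤_ (ℚP.+-identityʳ (Lq ℚ.* Lq)) (≡-sym D≡)
             (ℚP.+-monoʳ-≤ (Lq ℚ.* Lq) (*-nonNeg (ℕtoℚ-nonNeg 4) (ℕtoℚ-nonNeg (suc s))))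
    first-coefficient : ∀ {D twoS} → D ≡ Lq ℚ.* Lq ℚ.+ ℕtoℚ 4 ℚ.* Sq → twoS ≡ ℕtoℚ 2 ℚ.* Sq →
      half ℚ.* i ℚ.* (b ℚ.* D ℚ.- (twoS ℚ.* a ℚ.- Lq ℚ.* b) ℚ.* Lq) ≡ twoS ℚ.* (b ℚ.* i) ℚ.- Lq ℚ.* (a ℚ.- Lq ℚ.* b ℚ.* i)
    first-coefficient refl refl = unit-elim _ _ (ℚ.- (a ℚ.* Lq)) (ℕtoℚ-*-inv s)
      (solve 5 (λ a b L S i → con half :* i :* (b :* (L :* L :+ con (ℕtoℚ 4) :* S) :- (con (ℕtoℚ 2) :* S :* a :- L :* b) :* L)
         := con (ℕtoℚ 2) :* S :* (b :* i) :- L :* (a :- L :* b :* i) :+ (S :* i :- con 1ℚ) :* (:- (a :* L))) refl a b Lq Sq i)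
    second-coefficient : ∀ {twoS} → twoS ≡ ℕtoℚ 2 ℚ.* Sq →
      half ℚ.* i ℚ.* ((twoS ℚ.* a ℚ.- Lq ℚ.* b) ℚ.- b ℚ.* Lq) ≡ a ℚ.- Lq ℚ.* b ℚ.* i
    second-coefficient refl = unit-elim _ _ a (ℕtoℚ-*-inv s)
      (solve 5 (λ a b L S i → con half :* i :* ((con (ℕtoℚ 2) :* S :* a :- L :* b) :- b :* L)
         := a :- L :* b :* i :+ (S :* i :- con 1ℚ) :* a) refl a b Lq Sq i)

  nonneg-¬pos-neg : ∀ l0 S c b → Nonneg (suc l0) S (c , b) → Positive (suc l0) S (ℚ.- c , ℚ.- b) → ⊥
  nonneg-¬pos-neg l0 zero c b 0≤x 0<-x = ℚP.<-irrefl refl (ℚP.<-≤-trans (0<-⇒<0 0<-x′) 0≤x)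
    where
    0<-x′ : 0ℚ < ℚ.- (c ℚ.+ b ℚ.* inv l0)
    0<-x′ = subst (0ℚ <_) (solve 3 (λ c b i → (:- c) :+ (:- b) :* i := :- (c :+ b :* i)) refl c b (inv l0)) 0<-x
  nonneg-¬pos-neg l0 (suc s) c b 0≤x 0<-x =
    nonNegSqrt-¬posSqrt-neg {Dn = suc l0 ℕ.* suc l0 ℕ.+ 4 ℕ.* suc s} (ℕtoℚ-pos (l0 ℕ.+ l0 ℕ.* suc l0 ℕ.+ 4 ℕ.* suc s)) 0≤x
      (subst (λ u → PosSqrt u (ℚ.- b) (suc l0 ℕ.* suc l0 ℕ.+ 4 ℕ.* suc s))
        (solve 4 (λ t c L b → t :* (:- c) :- L :* (:- b) := :- (t :* c :- L :* b)) refl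
           (ℕtoℚ (2 ℕ.* suc s)) c (ℕtoℚ (suc l0)) b) 0<-x)

  positive-scale : ∀ l0 S k x → Positive (suc l0) S x → Positive (suc l0) S (scale (suc k) x)
  positive-scale l0 zero k (c , b) 0<x =
    subst (0ℚ <_) (solve 4 (λ K c b i → K :* (c :+ b :* i) := K :* c :+ (K :* b) :* i) refl (ℕtoℚ (suc k)) c b (inv l0))
      (*-pos (ℕtoℚ-pos k) 0<x)
  positive-scale l0 (suc s) k (c , b) 0<x =
    subst (λ u → PosSqrt u (ℕtoℚ (suc k) ℚ.* b) (suc l0 ℕ.* suc l0 ℕ.+ 4 ℕ.* suc s))
      (solve 5 (λ K t c L b → K :* (t :* c :- L :* b) := t :* (K :* c) :- L :* (K :* b)) refl
         (ℕtoℚ (suc k)) (ℕtoℚ (2 ℕ.* suc s)) c (ℕtoℚ (suc l0)) b)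
      (posSqrt-scale {Dn = suc l0 ℕ.* suc l0 ℕ.+ 4 ℕ.* suc s} (ℕtoℚ-pos k) 0<x)

open Nonnegativity

module Order (l0 S : ℕ) where
  open import Data.Nat as ℕ using (ℕ; zero; suc)
  import Data.Nat.Properties as ℕP
  open import Data.Rational as ℚ using (ℚ; 0ℚ; 1ℚ; _<_; _≤_)
  import Data.Rational.Properties as ℚP
  open import Data.Product using (_,_)
  open import Data.Empty using (⊥)
  open import Function using (_$_)
  open import Relation.Binary.PropositionalEquality
    using (_≡_; refl; isEquivalence; cong; cong₂; trans; subst)
    renaming (sym to ≡-sym)
  import Data.Rational.Solver as ℚ-Solver
  open import Relation.Binary.Bundles using (Preorder)
  import Relation.Binary.Reasoning.Preorder

  L : ℕ
  L = suc l0

  β : Qβ → Qβ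
  β = mulβ L S

  P : ℕ → Qβ
  P = powβ L S

  -- Cone x : x = Σ c_j β^j for finitely many rationals c_j ≥ 0, built in
  -- Horner form c + β y.  Every element of the cone is ≥ 0.
  data Cone : Qβ → Set where
    cone-zero : Cone zeroβ
    cone-step : ∀ {c x} → 0ℚ ≤ c → Cone x → Cone ((c , 0ℚ) ⊕ β x)

  cone-nonneg : ∀ {x} → Cone x → Nonneg L S x
  cone-nonneg cone-zero = nonneg-zero l0 S
  cone-nonneg (cone-step {c} {x} 0≤c cx) = nonneg-+const l0 S (β x) 0≤c (nonneg-β l0 S x (cone-nonneg cx))

  cone-¬pos-neg : ∀ {c b} → Cone (c , b) → Positive L S (ℚ.- c , ℚ.- b) → ⊥
  cone-¬pos-neg {c} {b} cx = nonneg-¬pos-neg l0 S c b (cone-nonneg cx)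

  cone-⊕ : ∀ {x y} → Cone x → Cone y → Cone (x ⊕ y)
  cone-⊕ {y = y} cone-zero cy = subst Cone (≡-sym (⊕-identityˡ y)) cy
  cone-⊕ {x = x} cx cone-zero = subst Cone (≡-sym (⊕-identityʳ x)) cx
  cone-⊕ (cone-step {c} {x} 0≤c cx) (cone-step {c′} {y} 0≤c′ cy) =
    subst Cone regroup (cone-step {c ℚ.+ c′} 0≤c+c′ (cone-⊕ cx cy))
    where
    0≤c+c′ : 0ℚ ≤ c ℚ.+ c′
    0≤c+c′ = ℚP.nonNegative⁻¹ _ {{ℚP.nonNeg+nonNeg⇒nonNeg c {{ℚ.nonNegative 0≤c}} c′ {{ℚ.nonNegative 0≤c′}}}}
    regroup : ((c , 0ℚ) ⊕ (c′ , 0ℚ)) ⊕ β (x ⊕ y) ≡ ((c , 0ℚ) ⊕ β x) ⊕ ((c′ , 0ℚ) ⊕ β y)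
    regroup = trans (cong (((c , 0ℚ) ⊕ (c′ , 0ℚ)) ⊕_) (mulβ-⊕ l0 S x y))
      (⊕-solve 4 (λ a b p q → (a ⊞ b) ⊞ (p ⊞ q) ⊜ (a ⊞ p) ⊞ (b ⊞ q)) refl (c , 0ℚ) (c′ , 0ℚ) (β x) (β y))

  cone-scale : ∀ k {x} → Cone x → Cone (scale k x)
  cone-scale zero    {x} cx = subst Cone (≡-sym (scale-zero x)) cone-zero
  cone-scale (suc k) {x} cx = subst Cone (≡-sym (scale-suc k x)) (cone-⊕ cx (cone-scale k cx))

  cone-β : ∀ {x} → Cone x → Cone (β x)
  cone-β {x} cx = subst Cone (⊕-identityˡ (β x)) (cone-step ℚP.≤-refl cx)

  cone-const : ∀ {c} → 0ℚ ≤ c → Cone (c , 0ℚ)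
  cone-const {c} 0≤c =
    subst Cone (trans (cong ((c , 0ℚ) ⊕_) (mulβ-zero l0 S)) (⊕-identityʳ (c , 0ℚ))) (cone-step 0≤c cone-zero)

  cone-pow : ∀ j → Cone (P j)
  cone-pow zero    = cone-const (ℚP.<⇒≤ (ℚP.positive⁻¹ 1ℚ))
  cone-pow (suc j) = cone-β (cone-pow j)

  -- x ≼ y : y - x lies in the cone, so x ≤ y as real numbers
  infix 4 _≼_
  record _≼_ (x y : Qβ) : Set where
    constructor ≼-by
    field
      {gap}  : Qβ
      cone   : Cone gap
      equals : x ⊕ gap ≡ y

  ≼-reflexive : ∀ {x y} → x ≡ y → x ≼ y
  ≼-reflexive {x} x≡y = ≼-by cone-zero (trans (⊕-identityʳ x) x≡y)

  ≼-refl : ∀ {x} → x ≼ x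
  ≼-refl = ≼-reflexive refl

  ≼-trans : ∀ {x y z} → x ≼ y → y ≼ z → x ≼ z
  ≼-trans {x} (≼-by {h} ch x+h≡y) (≼-by {h′} ch′ y+h′≡z) =
    ≼-by (cone-⊕ ch ch′) (trans (≡-sym (⊕-assoc x h h′)) (trans (cong (_⊕ h′) x+h≡y) y+h′≡z))

  ≼-preorder : Preorder _ _ _
  ≼-preorder = record
    { Carrier = Qβ ; _≈_ = _≡_ ; _≲_ = _≼_
    ; isPreorder = record { isEquivalence = isEquivalence ; reflexive = ≼-reflexive ; trans = ≼-trans } }

  module ≼-Reasoning = Relation.Binary.Reasoning.Preorder ≼-preorder

  ≼-⊕ : ∀ {x y z w} → x ≼ y → z ≼ w → x ⊕ z ≼ y ⊕ w
  ≼-⊕ {x} {z = z} (≼-by {h} ch refl) (≼-by {h′} ch′ refl) = ≼-by (cone-⊕ ch ch′)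
    (⊕-solve 4 (λ x z h h′ → (x ⊞ z) ⊞ (h ⊞ h′) ⊜ (x ⊞ h) ⊞ (z ⊞ h′)) refl x z h h′)

  ⊕-monoʳ-≼ : ∀ x {y z} → y ≼ z → x ⊕ y ≼ x ⊕ z
  ⊕-monoʳ-≼ x = ≼-⊕ (≼-refl {x})

  ⊕-monoˡ-≼ : ∀ z {x y} → x ≼ y → x ⊕ z ≼ y ⊕ z
  ⊕-monoˡ-≼ z x≼y = ≼-⊕ x≼y (≼-refl {z})

  ≼-⊕ʳ : ∀ x {h} → Cone h → x ≼ x ⊕ h
  ≼-⊕ʳ x ch = ≼-by ch refl

  ≼-scale : ∀ k {x y} → x ≼ y → scale k x ≼ scale k y
  ≼-scale k {x} (≼-by {h} ch refl) = ≼-by (cone-scale k ch) (≡-sym (scale-⊕ k x h))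

  scale-≼ : ∀ {m n x} → m ℕ.≤ n → Cone x → scale m x ≼ scale n x
  scale-≼ {m} {n} {x} m≤n cx = ≼-by (cone-scale (n ℕ.∸ m) cx) $
    trans (≡-sym (scale-+ m (n ℕ.∸ m) x)) (cong (λ k → scale k x) (ℕP.m+[n∸m]≡n m≤n))

  _⊖_ : Qβ → Qβ → Qβ
  (a , b) ⊖ (c , d) = a ℚ.- c , b ℚ.- d

  infix 4 _≺_
  record _≺_ (x y : Qβ) : Set where
    constructor ≺-by
    field positive : Positive L S (y ⊖ x)

  module _ where
    open ℚ-Solver.+-*-Solver

    <ᵣ⇒≺ : ∀ {q x} → q <ᵣ x within (L , S) → (q , 0ℚ) ≺ x
    <ᵣ⇒≺ {q} {a , b} q<x = ≺-by (subst (λ v → Positive L S (a ℚ.- q , v)) (≡-sym (ℚP.+-identityʳ b)) q<x)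

    <ₗ⇒≺ : ∀ {x q} → x <ₗ q within (L , S) → x ≺ (q , 0ℚ)
    <ₗ⇒≺ {a , b} {q} x<q = ≺-by (subst (λ v → Positive L S (q ℚ.- a , v)) (≡-sym (ℚP.+-identityˡ (ℚ.- b))) x<q)

    ≺-shift : ∀ {x y} z → x ≺ y → x ⊕ z ≺ y ⊕ z
    ≺-shift {a , b} {c , d} (e , f) (≺-by x≺y) = ≺-by (subst (Positive L S) (cong₂ _,_ (cancel c a e) (cancel d b f)) x≺y)
      where
      cancel : ∀ c a e → c ℚ.- a ≡ (c ℚ.+ e) ℚ.- (a ℚ.+ e)
      cancel = solve 3 (λ c a e → c :- a := (c :+ e) :- (a :+ e)) refl

    ≺-scale : ∀ k {x y} → x ≺ y → scale (suc k) x ≺ scale (suc k) y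
    ≺-scale k {a , b} {c , d} (≺-by x≺y) = ≺-by (subst (Positive L S) (cong₂ _,_ (distrib K c a) (distrib K d b))
      (positive-scale l0 S k _ x≺y))
      where
      K : ℚ
      K = ℕtoℚ (suc k)
      distrib : ∀ K c a → K ℚ.* (c ℚ.- a) ≡ K ℚ.* c ℚ.- K ℚ.* a
      distrib = solve 3 (λ K c a → K :* (c :- a) := K :* c :- K :* a) refl

    ≺-≼-contra : ∀ {x y} → x ≺ y → y ≼ x → ⊥
    ≺-≼-contra {y = c , d} (≺-by x≺y) (≼-by {h₁ , h₂} ch refl) = cone-¬pos-neg ch
      (subst (Positive L S) (cong₂ _,_ (diff c h₁) (diff d h₂)) x≺y)
      where
      diff : ∀ c h → c ℚ.- (c ℚ.+ h) ≡ ℚ.- h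
      diff = solve 2 (λ c h → c :- (c :+ h) := :- h) refl

  pow-relation : ∀ j → P j ≡ scale L (P (suc j)) ⊕ scale S (P (suc (suc j)))
  pow-relation = powβ-relation l0 S

  -- β^(j+1) ≤ β^j, as β^j = β^(j+1) + (L - 1) β^(j+1) + S β^(j+2)
  pow-≼ : ∀ j → P (suc j) ≼ P j
  pow-≼ j = ≼-by (cone-⊕ (cone-scale l0 (cone-pow (suc j))) (cone-scale S (cone-pow (suc (suc j))))) $
    ≡-sym (trans (pow-relation j) (trans (cong (_⊕ scale S (P (suc (suc j)))) (scale-suc l0 (P (suc j))))
                                         (⊕-assoc (P (suc j)) _ _)))

  -- β^j ≤ (L + S) β^(j+1), since β^(j+2) ≤ β^(j+1)
  pow-≼-scale : ∀ j → P j ≼ scale (L ℕ.+ S) (P (suc j))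
  pow-≼-scale j = begin
    P j                                                 ≡⟨ pow-relation j ⟩
    scale L (P (suc j)) ⊕ scale S (P (suc (suc j)))     ≲⟨ ⊕-monoʳ-≼ (scale L (P (suc j))) (≼-scale S (pow-≼ (suc j))) ⟩
    scale L (P (suc j)) ⊕ scale S (P (suc j))           ≡⟨ scale-+ L S (P (suc j)) ⟨
    scale (L ℕ.+ S) (P (suc j))                         ∎
    where open ≼-Reasoning

module Digits (l0 S : ℕ) where
  open import Data.Nat as ℕ using (ℕ; suc)
  import Data.Nat.Properties as ℕP
  open import Relation.Nullary using (yes; no)
  open import Relation.Binary.PropositionalEquality
    using (_≡_; cong; cong₂; trans; subst; module ≡-Reasoning)
  open Order l0 S

  -- digit j η : the term added to ξ when the digit η is written at level j,
  -- namely min(L, η+1) β^(j+1) + max(η+1-L, 0) β^(j+2)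
  digit : ℕ → ℕ → Qβ
  digit j η = scale (L ℕ.⊓ suc η) (P (suc j)) ⊕ scale (suc η ℕ.∸ L) (P (suc (suc j)))

  digit-cone : ∀ j η → Cone (digit j η)
  digit-cone j η = cone-⊕ (cone-scale (L ℕ.⊓ suc η) (cone-pow (suc j))) (cone-scale (suc η ℕ.∸ L) (cone-pow (suc (suc j))))

  digit-small : ∀ j {η} → η ℕ.< L → digit j η ≡ scale (suc η) (P (suc j))
  digit-small j {η} η<L =
    trans (cong₂ (λ m n → scale m (P (suc j)) ⊕ scale n (P (suc (suc j)))) (ℕP.m≥n⇒m⊓n≡n η<L) (ℕP.m≤n⇒m∸n≡0 η<L))
          (trans (cong (scale (suc η) (P (suc j)) ⊕_) (scale-zero (P (suc (suc j))))) (⊕-identityʳ (scale (suc η) (P (suc j)))))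

  digit-large : ∀ j {η} → l0 ℕ.≤ η → digit j η ≡ scale L (P (suc j)) ⊕ scale (η ℕ.∸ l0) (P (suc (suc j)))
  digit-large j {η} l0≤η = cong (λ m → scale m (P (suc j)) ⊕ scale (η ℕ.∸ l0) (P (suc (suc j)))) (ℕP.m≤n⇒m⊓n≡m (ℕ.s≤s l0≤η))

  pow-≼-digit : ∀ j η → P (suc j) ≼ digit j η
  pow-≼-digit j η = begin
    P (suc j)                               ≡⟨ scale-one (P (suc j)) ⟨
    scale 1 (P (suc j))                     ≲⟨ scale-≼ {1} {L ℕ.⊓ suc η} (ℕP.⊓-glb (ℕ.s≤s ℕ.z≤n) (ℕ.s≤s ℕ.z≤n)) (cone-pow (suc j)) ⟩
    scale (L ℕ.⊓ suc η) (P (suc j))         ≲⟨ ≼-⊕ʳ (scale (L ℕ.⊓ suc η) (P (suc j))) (cone-scale (suc η ℕ.∸ L) (cone-pow (suc (suc j)))) ⟩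
    digit j η                               ∎
    where open ≼-Reasoning

  digit-step-small : ∀ j {η} → suc η ℕ.< L → digit j η ⊕ P (suc j) ≡ digit j (suc η)
  digit-step-small j {η} η+1<L = begin
    digit j η ⊕ P (suc j)                  ≡⟨ cong (_⊕ P (suc j)) (digit-small j (ℕP.<-trans (ℕP.n<1+n η) η+1<L)) ⟩
    scale (suc η) (P (suc j)) ⊕ P (suc j)  ≡⟨ ⊕-comm (scale (suc η) (P (suc j))) (P (suc j)) ⟩
    P (suc j) ⊕ scale (suc η) (P (suc j))  ≡⟨ scale-suc (suc η) (P (suc j)) ⟨
    scale (suc (suc η)) (P (suc j))        ≡⟨ digit-small j η+1<L ⟨
    digit j (suc η)                        ∎
    where open ≡-Reasoning

  digit-large-step : ∀ j {η} → l0 ℕ.≤ η →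
    digit j η ⊕ P (suc (suc j)) ≡ scale L (P (suc j)) ⊕ scale (suc (η ℕ.∸ l0)) (P (suc (suc j)))
  digit-large-step j {η} l0≤η = begin
    digit j η ⊕ P2                                   ≡⟨ cong (_⊕ P2) (digit-large j l0≤η) ⟩
    (scale L P1 ⊕ scale (η ℕ.∸ l0) P2) ⊕ P2          ≡⟨ ⊕-assoc (scale L P1) (scale (η ℕ.∸ l0) P2) P2 ⟩
    scale L P1 ⊕ (scale (η ℕ.∸ l0) P2 ⊕ P2)          ≡⟨ cong (scale L P1 ⊕_) (⊕-comm (scale (η ℕ.∸ l0) P2) P2) ⟩
    scale L P1 ⊕ (P2 ⊕ scale (η ℕ.∸ l0) P2)          ≡⟨ cong (scale L P1 ⊕_) (scale-suc (η ℕ.∸ l0) P2) ⟨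
    scale L P1 ⊕ scale (suc (η ℕ.∸ l0)) P2           ∎
    where
    open ≡-Reasoning
    P1 P2 : Qβ
    P1 = P (suc j)
    P2 = P (suc (suc j))

  digit-step : ∀ j η → digit j η ⊕ P (suc (suc j)) ≼ digit j (suc η)
  digit-step j η with suc η ℕ.<? L
  ... | yes η+1<L = ≼-trans (⊕-monoʳ-≼ (digit j η) (pow-≼ (suc j))) (≼-reflexive (digit-step-small j η+1<L))
  ... | no  η+1≮L = ≼-reflexive (begin
    digit j η ⊕ P (suc (suc j))                                 ≡⟨ digit-large-step j l0≤η ⟩
    scale L (P (suc j)) ⊕ scale (suc (η ℕ.∸ l0)) (P (suc (suc j))) ≡⟨ cong (λ n → scale L (P (suc j)) ⊕ scale n (P (suc (suc j)))) (ℕP.+-∸-assoc 1 l0≤η) ⟨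
    scale L (P (suc j)) ⊕ scale (suc η ℕ.∸ l0) (P (suc (suc j)))   ≡⟨ digit-large j (ℕP.m≤n⇒m≤1+n l0≤η) ⟨
    digit j (suc η)                                               ∎)
    where
    open ≡-Reasoning
    l0≤η : l0 ℕ.≤ η
    l0≤η = ℕP.≤-pred (ℕP.≮⇒≥ η+1≮L)

  digit-bound-long : ∀ j {η} → η ℕ.< l0 → digit j η ⊕ P (suc j) ≼ P j
  digit-bound-long j {η} η<l0 = begin
    digit j η ⊕ P (suc j)                            ≡⟨ digit-step-small j (ℕ.s≤s η<l0) ⟩
    digit j (suc η)                                  ≡⟨ digit-small j (ℕ.s≤s η<l0) ⟩
    scale (suc (suc η)) (P (suc j))                  ≲⟨ scale-≼ {suc (suc η)} {L} (ℕ.s≤s η<l0) (cone-pow (suc j)) ⟩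
    scale L (P (suc j))                              ≲⟨ ≼-⊕ʳ (scale L (P (suc j))) (cone-scale S (cone-pow (suc (suc j)))) ⟩
    scale L (P (suc j)) ⊕ scale S (P (suc (suc j)))  ≡⟨ pow-relation j ⟨
    P j                                              ∎
    where open ≼-Reasoning

  digit-bound : ∀ j {η} → η ℕ.< l0 ℕ.+ S → digit j η ⊕ P (suc (suc j)) ≼ P j
  digit-bound j {η} η<K with η ℕ.<? l0
  ... | yes η<l0 = ≼-trans (⊕-monoʳ-≼ (digit j η) (pow-≼ (suc j))) (digit-bound-long j η<l0)
  ... | no  η≮l0 = begin
    digit j η ⊕ P2                                   ≡⟨ digit-large-step j l0≤η ⟩
    scale L P1 ⊕ scale (suc (η ℕ.∸ l0)) P2           ≲⟨ ⊕-monoʳ-≼ (scale L P1) (scale-≼ {suc (η ℕ.∸ l0)} {S} η-l0<S (cone-pow (suc (suc j)))) ⟩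
    scale L P1 ⊕ scale S P2                          ≡⟨ pow-relation j ⟨
    P j                                              ∎
    where
    open ≼-Reasoning
    P1 P2 : Qβ
    P1 = P (suc j)
    P2 = P (suc (suc j))
    l0≤η : l0 ℕ.≤ η
    l0≤η = ℕP.≮⇒≥ η≮l0
    η-l0<S : η ℕ.∸ l0 ℕ.< S
    η-l0<S = subst (η ℕ.∸ l0 ℕ.<_) (ℕP.m+n∸m≡n l0 S) (ℕP.∸-monoˡ-< η<K l0≤η)

open import Data.Nat as ℕ using (ℕ; zero; suc; _+_; _*_; _∸_; _≤_; _<_; z≤n; s≤s)
import Data.Nat.Properties as ℕP
open import Data.Nat.DivMod using (m%n≤m; n%1≡0; n/1≡n; m≡m%n+[m/n]*n; m%n<n; m<n*o⇒m/o<n)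
open import Data.Nat.Divisibility
  using (_∣_; divides; ∣-trans; ∣m∣n⇒∣m+n; ∣m⇒∣m*n; ∣n⇒∣m*n; ∣m+n∣m⇒∣n; ∣1⇒≡1; n∣m*n)
open import Data.Nat.GCD using (gcd; gcd[m,n]∣m; gcd[m,n]∣n)
open import Data.Nat.Solver using (module +-*-Solver)
open import Data.Rational as ℚ using (0ℚ; 1ℚ)
import Data.Rational.Properties as ℚP
import Data.Rational.Solver
open import Data.Product using (Σ; _×_; _,_; proj₁; proj₂)
open import Data.Bool using (true; false; T)
open import Data.Unit using (tt)
open import Data.Empty using (⊥-elim)
open import Relation.Nullary using (¬_; yes; no)
open import Relation.Binary.PropositionalEquality
  using (_≡_; refl; cong; cong₂; trans; subst; module ≡-Reasoning)
  renaming (sym to ≡-sym)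

module Blocks (l0 S : ℕ) (1≤K : 1 ≤ l0 + S) where
  open Digits l0 S using (digit)

  L : ℕ
  L = suc l0

  -- K = L + S - 1 ≥ 1 is the number of blocks of length l_n in [t_n, t_{n+1})
  K : ℕ
  K = l0 + S

  t′ l′ : ℕ → ℕ
  t′ = t L S
  l′ = l L S

  block-recurrences : ∀ n → t′ (suc n) ≡ t′ n + K * l′ n × l′ (suc n) ≡ t′ n + l0 * l′ n
  block-recurrences zero = cong suc (≡-sym (ℕP.*-identityʳ K)) , cong suc (≡-sym (ℕP.*-identityʳ l0))
  block-recurrences (suc n) with block-recurrences n
  ... | t-rec , l-rec = t-goal , l-goal
    where
    open +-*-Solver
    tn ln : ℕ
    tn = t′ n
    ln = l′ n
    t-goal : L * t′ (suc n) + S * tn ≡ t′ (suc n) + K * l′ (suc n)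
    t-goal rewrite t-rec | l-rec =
      solve 4 (λ l0 S tn ln → (con 1 :+ l0) :* (tn :+ (l0 :+ S) :* ln) :+ S :* tn
                              := (tn :+ (l0 :+ S) :* ln) :+ (l0 :+ S) :* (tn :+ l0 :* ln)) refl l0 S tn ln
    l-goal : L * l′ (suc n) + S * ln ≡ t′ (suc n) + l0 * l′ (suc n)
    l-goal rewrite t-rec | l-rec =
      solve 4 (λ l0 S tn ln → (con 1 :+ l0) :* (tn :+ l0 :* ln) :+ S :* ln
                              := (tn :+ (l0 :+ S) :* ln) :+ l0 :* (tn :+ l0 :* ln)) refl l0 S tn ln

  t-suc : ∀ n → t′ (suc n) ≡ t′ n + K * l′ n
  t-suc n = proj₁ (block-recurrences n)

  l-suc : ∀ n → l′ (suc n) ≡ t′ n + l0 * l′ n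
  l-suc n = proj₂ (block-recurrences n)

  t-pos : ∀ n → 1 ≤ t′ n
  t-pos zero    = s≤s z≤n
  t-pos (suc n) rewrite t-suc n = ℕP.≤-trans (t-pos n) (ℕP.m≤m+n (t′ n) (K * l′ n))

  l-pos : ∀ n → 1 ≤ l′ n
  l-pos zero    = s≤s z≤n
  l-pos (suc n) rewrite l-suc n = ℕP.≤-trans (t-pos n) (ℕP.m≤m+n (t′ n) (l0 * l′ n))

  l≤t : ∀ n → l′ n ≤ t′ n
  l≤t zero    = ℕP.≤-refl
  l≤t (suc n) rewrite l-suc n | t-suc n = ℕP.+-monoʳ-≤ (t′ n) (ℕP.*-monoˡ-≤ (l′ n) (ℕP.m≤m+n l0 S))

  t-strict : ∀ n → t′ n < t′ (suc n)
  t-strict n rewrite t-suc n =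
    subst (_≤ t′ n + K * l′ n) (ℕP.+-comm (t′ n) 1) (ℕP.+-monoʳ-≤ (t′ n) (ℕP.*-mono-≤ 1≤K (l-pos n)))

  t-mono : ∀ {m n} → m ≤ n → t′ m ≤ t′ n
  t-mono {m} {zero}  m≤0 = ℕP.≤-reflexive (cong t′ (ℕP.n≤0⇒n≡0 m≤0))
  t-mono {m} {suc n} m≤1+n with m ℕ.≤? n
  ... | yes m≤n = ℕP.≤-trans (t-mono m≤n) (ℕP.<⇒≤ (t-strict n))
  ... | no  m≰n = ℕP.≤-reflexive (cong t′ (ℕP.≤-antisym m≤1+n (ℕP.≰⇒> m≰n)))

  n<t : ∀ n → n < t′ n
  n<t zero    = s≤s z≤n
  n<t (suc n) = ℕP.<-≤-trans (s≤s (n<t n)) (t-strict n)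

  level-correct : ∀ {N m} → t′ m ≤ N → N < t′ (suc m) → level L S N N ≡ m
  level-correct {N} {m} tm≤N N<tm+1 = search N (ℕP.<⇒≤ (ℕP.<-≤-trans (n<t m) tm≤N))
    where
    search : ∀ k → m ≤ k → level L S N k ≡ m
    search zero    m≤0 = ≡-sym (ℕP.n≤0⇒n≡0 m≤0)
    search (suc k) m≤k+1 with t′ (suc k) ℕ.≤ᵇ N in found
    ... | true  = ℕP.≤-antisym k+1≤m m≤k+1
      where
      k+1≤m : suc k ≤ m
      k+1≤m with suc k ℕ.≤? m
      ... | yes k+1≤m = k+1≤m
      ... | no  k+1≰m = ⊥-elim (ℕP.<-irrefl refl (ℕP.<-≤-trans N<tm+1
              (ℕP.≤-trans (t-mono (ℕP.≰⇒> k+1≰m)) (ℕP.≤ᵇ⇒≤ (t′ (suc k)) N (subst T (≡-sym found) tt)))))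
    ... | false with m ℕ.≤? k
    ...   | yes m≤k = search k m≤k
    ...   | no  m≰k = ⊥-elim (subst T found (ℕP.≤⇒≤ᵇ (subst (λ j → t′ j ≤ N) m≡k+1 tm≤N)))
      where
      m≡k+1 : m ≡ suc k
      m≡k+1 = ℕP.≤-antisym m≤k+1 (ℕP.≰⇒> m≰k)

  modN-≤ : ∀ m k → modN m k ≤ m
  modN-≤ m zero    = ℕP.≤-refl
  modN-≤ m (suc k) = m%n≤m m (suc k)

  remainder-< : ∀ N n → modN (suc N ∸ t′ n) (l′ n) ≤ N
  remainder-< N n = ℕP.≤-trans (modN-≤ (suc N ∸ t′ n) (l′ n)) (ℕP.∸-monoʳ-≤ (suc N) (t-pos n))

  fuel-irrelevant : ∀ f g r → r ≤ f → r ≤ g → ξF L S f r ≡ ξF L S g r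
  fuel-irrelevant zero    zero    zero    _ _ = refl
  fuel-irrelevant zero    (suc g) zero    _ _ = refl
  fuel-irrelevant (suc f) zero    zero    _ _ = refl
  fuel-irrelevant (suc f) (suc g) zero    _ _ = refl
  fuel-irrelevant (suc f) (suc g) (suc r) (s≤s r≤f) (s≤s r≤g) =
    cong (_⊕ _) (fuel-irrelevant f g _ (ℕP.≤-trans (remainder-< r n) r≤f) (ℕP.≤-trans (remainder-< r n) r≤g))
    where n = level L S (suc r) (suc r)

  unfold : ∀ m N → t′ m ≤ N → N < t′ (suc m) →
           ξ L S N ≡ ξ L S (modN (N ∸ t′ m) (l′ m)) ⊕ digit m (divN (N ∸ t′ m) (l′ m))
  unfold m zero    tm≤0 _ = ⊥-elim (ℕP.<-irrefl refl (ℕP.<-≤-trans (t-pos m) tm≤0))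
  unfold m (suc N) tm≤N N<tm+1 = begin
    ξ L S (suc N)                                     ≡⟨ cong step (level-correct {suc N} {m} tm≤N N<tm+1) ⟩
    ξF L S N (remainder m) ⊕ digit m (quotient m)      ≡⟨ cong (_⊕ digit m (quotient m))
                                                         (fuel-irrelevant N (remainder m) (remainder m) (remainder-< N m) ℕP.≤-refl) ⟩
    ξ L S (remainder m) ⊕ digit m (quotient m)         ∎
    where
    open ≡-Reasoning
    remainder quotient : ℕ → ℕ
    remainder n = modN (suc N ∸ t′ n) (l′ n)
    quotient  n = divN (suc N ∸ t′ n) (l′ n)
    step : ℕ → Qβ
    step n = ξF L S N (remainder n) ⊕ digit n (quotient n)

  ξ-first-block : ∀ b → suc b < L + S → ξ L S (suc b) ≡ digit 0 b
  ξ-first-block b b+1<L+S = begin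
    ξ L S (suc b)                          ≡⟨ unfold 0 (suc b) (s≤s z≤n) b+1<L+S ⟩
    ξ L S (b ℕ.% 1) ⊕ digit 0 (b ℕ./ 1)    ≡⟨ cong₂ (λ r η → ξ L S r ⊕ digit 0 η) (n%1≡0 b) (n/1≡n b) ⟩
    zeroβ ⊕ digit 0 b                      ≡⟨ ⊕-identityˡ (digit 0 b) ⟩
    digit 0 b                              ∎
    where open ≡-Reasoning

divN-modN : ∀ M k → 1 ≤ k → M ≡ modN M k + divN M k * k
divN-modN M (suc k) _ = m≡m%n+[m/n]*n M (suc k)

modN-< : ∀ M k → 1 ≤ k → modN M k < k
modN-< M (suc k) _ = m%n<n M (suc k)

divN-< : ∀ {M c} k → 1 ≤ k → M < c * k → divN M k < c
divN-< {M} {c} (suc k) _ M<ck = m<n*o⇒m/o<n {M} {c} {suc k} M<ck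

Congruent : ℕ → ℕ → ℕ → Set
Congruent d M b = Σ ℕ λ k → M ≡ b + k * d

congruent-shift : ∀ {d r b A B} η → d ∣ A → d ∣ B → Congruent d r b → Congruent d (A + (r + η * B)) b
congruent-shift {d} {r} {b} η (divides x refl) (divides y refl) (k , refl) =
  x + (k + η * y) , solve 6 (λ x d b k η y → x :* d :+ (b :+ k :* d :+ η :* (y :* d))
                             := b :+ (x :+ (k :+ η :* y)) :* d) refl x d b k η y
  where open +-*-Solver

residues-collide : ∀ {d N b} → d ∣ N → Congruent d N b → d ∣ suc b → d ≡ 1
residues-collide {d} {N} {b} d∣N (k , N≡b+kd) d∣b+1 = ∣1⇒≡1 (∣m+n∣m⇒∣n (subst (d ∣_) (ℕP.+-comm 1 b) d∣b+1) d∣b)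
  where
  d∣b : d ∣ b
  d∣b = ∣m+n∣m⇒∣n (subst (d ∣_) (trans N≡b+kd (ℕP.+-comm b (k * d))) d∣N) (n∣m*n k)

-- Every N has a first digit b < L + S with N ≡ b (mod d), and ξ^N lies in
-- the first-level interval [ξ^b, digit 0 b] of that digit, with a margin
-- that is proved by induction over the blocks [t_m, t_{m+1}).
module FirstDigits (l0 S : ℕ) (1≤K : 1 ≤ l0 + S) (d : ℕ) (d∣L : d ∣ suc l0) (d∣S : d ∣ S) where
  open Order l0 S
  open Digits l0 S
  open Blocks l0 S 1≤K hiding (L)

  ξ′ : ℕ → Qβ
  ξ′ = ξ L S

  d∣t : ∀ n → d ∣ t′ (suc n)
  d∣t zero    = ∣m∣n⇒∣m+n d∣L d∣S
  d∣t (suc n) = ∣m∣n⇒∣m+n (∣n⇒∣m*n L (d∣t n)) (∣m⇒∣m*n (t′ n) d∣S)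

  d∣l : ∀ n → d ∣ l′ (suc n)
  d∣l zero    = d∣L
  d∣l (suc n) = ∣m∣n⇒∣m+n (∣n⇒∣m*n L (d∣l n)) (∣m⇒∣m*n (l′ n) d∣S)

  -- b is the first digit of N at resolution β^m: ξ^b ≤ ξ^N and
  -- ξ^N + β^(m+1) ≤ digit 0 b (the end of I_b), even ξ^N + β^m ≤ digit 0 b
  -- when N < l_m
  record FirstDigit (m N : ℕ) : Set where
    field
      b           : ℕ
      b<L+S       : b < L + S
      residue     : Congruent d N b
      lower       : ξ′ b ≼ ξ′ N
      upper       : ξ′ N ⊕ P (suc m) ≼ digit 0 b
      upper-short : N < l′ m → ξ′ N ⊕ P m ≼ digit 0 b

  first-block : ∀ N → N < t′ 1 → FirstDigit 1 N
  first-block N N<L+S = record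
    { b = N ; b<L+S = N<L+S ; residue = 0 , ≡-sym (ℕP.+-identityʳ N) ; lower = ≼-refl
    ; upper = upper N N<L+S ; upper-short = upper-short N }
    where
    upper : ∀ N → N < L + S → ξ′ N ⊕ P 2 ≼ digit 0 N
    upper zero    _ = ≼-trans (≼-reflexive (⊕-identityˡ (P 2))) (≼-trans (pow-≼ 1) (pow-≼-digit 0 0))
    upper (suc b) b+1<L+S = subst (λ x → x ⊕ P 2 ≼ digit 0 (suc b)) (≡-sym (ξ-first-block b b+1<L+S)) (digit-step 0 b)
    upper-short : ∀ N → N < L → ξ′ N ⊕ P 1 ≼ digit 0 N
    upper-short zero    _ = ≼-trans (≼-reflexive (⊕-identityˡ (P 1))) (pow-≼-digit 0 0)
    upper-short (suc b) b+1<L = subst (λ x → x ⊕ P 1 ≼ digit 0 (suc b))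
      (≡-sym (ξ-first-block b (ℕP.<-≤-trans b+1<L (ℕP.m≤m+n L S)))) (≼-reflexive (digit-step-small 0 b+1<L))

  refine : ∀ {m N} → FirstDigit m N → FirstDigit (suc m) N
  refine {m} {N} fd = record
    { b = b ; b<L+S = b<L+S ; residue = residue ; lower = lower
    ; upper = ≼-trans (⊕-monoʳ-≼ (ξ′ N) (pow-≼ (suc m))) upper
    ; upper-short = λ _ → upper }
    where open FirstDigit fd

  -- N = t_M + η l_M + r in a new block inherits the first digit of r < l_M;
  -- the digit bounds absorb the new digit η into the margin of r
  new-block : ∀ m → (∀ r → r < t′ (suc m) → FirstDigit (suc m) r) →
              ∀ N → t′ (suc m) ≤ N → N < t′ (suc (suc m)) → FirstDigit (suc (suc m)) N
  new-block m earlier N tM≤N N<tM+1 = record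
    { b = b ; b<L+S = b<L+S
    ; residue = subst (λ x → Congruent d x b) (≡-sym N≡) (congruent-shift η (d∣t m) (d∣l m) residue)
    ; lower = ≼-trans lower (subst (ξ′ r ≼_) (≡-sym ξN≡) (≼-⊕ʳ (ξ′ r) (digit-cone M η)))
    ; upper = below-digit (suc (suc M)) (digit-bound M η<K)
    ; upper-short = λ N<lM+1 → below-digit (suc M) (digit-bound-long M (η<l0 N<lM+1)) }
    where
    M M′ η r : ℕ
    M = suc m
    M′ = N ∸ t′ M
    η = divN M′ (l′ M)
    r = modN M′ (l′ M)
    r<lM : r < l′ M
    r<lM = modN-< M′ (l′ M) (l-pos M)
    open FirstDigit (earlier r (ℕP.<-≤-trans r<lM (l≤t M)))
    N≡ : N ≡ t′ M + (r + η * l′ M)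
    N≡ = trans (≡-sym (ℕP.m+[n∸m]≡n tM≤N)) (cong (t′ M +_) (divN-modN M′ (l′ M) (l-pos M)))
    ξN≡ : ξ′ N ≡ ξ′ r ⊕ digit M η
    ξN≡ = unfold M N tM≤N N<tM+1
    digit-< : ∀ {c} → N < t′ M + c * l′ M → η < c
    digit-< N<tM+clM = divN-< (l′ M) (l-pos M)
      (subst (M′ <_) (ℕP.m+n∸m≡n (t′ M) _) (ℕP.∸-monoˡ-< N<tM+clM tM≤N))
    η<K : η < K
    η<K = digit-< (subst (N <_) (t-suc M) N<tM+1)
    η<l0 : N < l′ (suc M) → η < l0
    η<l0 N<lM+1 = digit-< (subst (N <_) (l-suc M) N<lM+1)
    below-digit : ∀ j → digit M η ⊕ P j ≼ P M → ξ′ N ⊕ P j ≼ digit 0 b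
    below-digit j bound = begin
      ξ′ N ⊕ P j                   ≡⟨ cong (_⊕ P j) ξN≡ ⟩
      (ξ′ r ⊕ digit M η) ⊕ P j     ≡⟨ ⊕-assoc (ξ′ r) (digit M η) (P j) ⟩
      ξ′ r ⊕ (digit M η ⊕ P j)     ≲⟨ ⊕-monoʳ-≼ (ξ′ r) bound ⟩
      ξ′ r ⊕ P M                   ≲⟨ upper-short r<lM ⟩
      digit 0 b                    ∎
      where open ≼-Reasoning

  first-digit : ∀ m N → N < t′ (suc m) → FirstDigit (suc m) N
  first-digit zero    = first-block
  first-digit (suc m) N N<tm+2 with N ℕ.<? t′ (suc m)
  ... | yes N<tm+1 = refine (first-digit m N N<tm+1)
  ... | no  N≮tm+1 = new-block m (first-digit m) N (ℕP.≮⇒≥ N≮tm+1) N<tm+2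

  first-digit-of : ∀ N → FirstDigit (suc N) N
  first-digit-of N = first-digit N N (ℕP.<-trans (ℕP.n<1+n N) (n<t (suc N)))

  -- ξ^N < 1/(L+S) forces the first digit 0, since every other first-level
  -- interval starts at β ≥ 1/(L+S); hence d ∣ N
  below-first-interval : ∀ N {q} → ℕtoℚ (suc K) ℚ.* q ≡ 1ℚ → ξ′ N ≺ (q , 0ℚ) → d ∣ N
  below-first-interval N {q} Kq≡1 ξN≺q with first-digit-of N
  ... | record { b = zero ; residue = k , N≡kd } = divides k N≡kd
  ... | record { b = suc b ; b<L+S = b+1<L+S ; lower = lower } = ⊥-elim (≺-≼-contra Kξ≺1 1≼Kξ)
    where
    Kξ≺1 : scale (suc K) (ξ′ N) ≺ P 0
    Kξ≺1 = subst (scale (suc K) (ξ′ N) ≺_) (cong₂ _,_ Kq≡1 (ℚP.*-zeroʳ (ℕtoℚ (suc K)))) (≺-scale K ξN≺q)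
    1≼Kξ : P 0 ≼ scale (suc K) (ξ′ N)
    1≼Kξ = begin
      P 0                          ≲⟨ pow-≼-scale 0 ⟩
      scale (suc K) (P 1)          ≲⟨ ≼-scale (suc K) (pow-≼-digit 0 b) ⟩
      scale (suc K) (digit 0 b)    ≡⟨ cong (scale (suc K)) (ξ-first-block b b+1<L+S) ⟨
      scale (suc K) (ξ′ (suc b))   ≲⟨ ≼-scale (suc K) lower ⟩
      scale (suc K) (ξ′ N)         ∎
      where open ≼-Reasoning

  -- ξ^N > 1 - 1/(L+S)² forces the last first digit L + S - 1, since every
  -- other first-level interval ends by 1 - β² ≤ 1 - 1/(L+S)²
  above-last-interval : ∀ N {w} → ℕtoℚ (suc K ℕ.* suc K) ℚ.* w ≡ 1ℚ → (1ℚ ℚ.- w , 0ℚ) ≺ ξ′ N →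
                        Σ ℕ λ b → Congruent d N b × suc b ≡ L + S
  above-last-interval N {w} K²w≡1 1-w≺ξN with first-digit-of N
  ... | record { b = b ; b<L+S = b<L+S ; residue = residue ; upper = upper } with suc b ℕ.<? L + S
  ...   | no  b+1≮L+S = b , residue , ℕP.≤-antisym b<L+S (ℕP.≮⇒≥ b+1≮L+S)
  ...   | yes b+1<L+S = ⊥-elim (≺-≼-contra K²≺K²ξ+1 K²ξ+1≼K²)
    where
    K² : ℕ
    K² = suc K ℕ.* suc K
    ξN+β²≤1 : ξ′ N ⊕ P 2 ≼ P 0
    ξN+β²≤1 = begin
      ξ′ N ⊕ P 2                    ≲⟨ ⊕-monoˡ-≼ (P 2) (≼-⊕ʳ (ξ′ N) (cone-pow (suc (suc N)))) ⟩
      (ξ′ N ⊕ P (suc (suc N))) ⊕ P 2 ≲⟨ ⊕-monoˡ-≼ (P 2) upper ⟩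
      digit 0 b ⊕ P 2                ≲⟨ digit-bound 0 (ℕP.≤-pred b+1<L+S) ⟩
      P 0                            ∎
      where open ≼-Reasoning
    1≤K²β² : P 0 ≼ scale K² (P 2)
    1≤K²β² = begin
      P 0                            ≲⟨ pow-≼-scale 0 ⟩
      scale (suc K) (P 1)            ≲⟨ ≼-scale (suc K) (pow-≼-scale 1) ⟩
      scale (suc K) (scale (suc K) (P 2)) ≡⟨ scale-* (suc K) (suc K) (P 2) ⟩
      scale K² (P 2)                 ∎
      where open ≼-Reasoning
    K²ξ+1≼K² : scale K² (ξ′ N) ⊕ P 0 ≼ scale K² (P 0)
    K²ξ+1≼K² = begin
      scale K² (ξ′ N) ⊕ P 0          ≲⟨ ⊕-monoʳ-≼ (scale K² (ξ′ N)) 1≤K²β² ⟩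
      scale K² (ξ′ N) ⊕ scale K² (P 2) ≡⟨ scale-⊕ K² (ξ′ N) (P 2) ⟨
      scale K² (ξ′ N ⊕ P 2)          ≲⟨ ≼-scale K² ξN+β²≤1 ⟩
      scale K² (P 0)                 ∎
      where open ≼-Reasoning
    K²≺K²ξ+1 : scale K² (P 0) ≺ scale K² (ξ′ N) ⊕ P 0
    K²≺K²ξ+1 = subst (_≺ scale K² (ξ′ N) ⊕ P 0) (cong₂ _,_ first (ℚP.+-identityʳ (ℕtoℚ K² ℚ.* 0ℚ)))
      (≺-shift (P 0) (≺-scale (K ℕ.+ K ℕ.* suc K) 1-w≺ξN))
      where
      first : ℕtoℚ K² ℚ.* (1ℚ ℚ.- w) ℚ.+ 1ℚ ≡ ℕtoℚ K² ℚ.* 1ℚ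
      first = unit-elim _ _ (ℚ.- 1ℚ) K²w≡1
        (solve 2 (λ k w → k :* (con 1ℚ :- w) :+ con 1ℚ := k :* con 1ℚ :+ (k :* w :- con 1ℚ) :* (:- con 1ℚ)) refl (ℕtoℚ K²) w)
        where open Data.Rational.Solver.+-*-Solver

-- The box (0, 1/(L₁+S₁)) × (1 - 1/(L₂+S₂)², 1) contains no point: the first
-- coordinate of a point there gives d ∣ N, the second N ≡ L₂ + S₂ - 1 (mod d).
theorem2 : (L₁ S₁ L₂ S₂ : ℕ) → 1 ≤ L₁ → 1 ≤ L₂ → 2 ≤ L₁ + S₁ → 2 ≤ L₂ + S₂ →
  1 < gcd (gcd L₁ S₁) (gcd L₂ S₂) → ¬ Dense2 L₁ S₁ L₂ S₂
theorem2 L₁@(suc l₁) S₁ L₂@(suc l₂) S₂ _ _ (s≤s 1≤K₁) (s≤s 1≤K₂) 1<d dense =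
  let N , _ , ξ₁<1/K₁ , 1-1/K₂²<ξ₂ , _ = dense 0ℚ (inv K₁) (1ℚ ℚ.- inv K₂²-1) 1ℚ
        ℚP.≤-refl (inv-pos K₁) (inv-≤-1 K₁) (1-inv-nonNeg K₂²-1) (1-inv-<-1 K₂²-1) ℚP.≤-refl
  in ℕP.<-irrefl (≡-sym (d≡1 N ξ₁<1/K₁ 1-1/K₂²<ξ₂)) 1<d
  where
  K₁ K₂²-1 d : ℕ
  K₁ = l₁ + S₁
  K₂²-1 = (l₂ + S₂) + (l₂ + S₂) * suc (l₂ + S₂)
  d = gcd (gcd L₁ S₁) (gcd L₂ S₂)
  d∣L₁ : d ∣ L₁
  d∣L₁ = ∣-trans (gcd[m,n]∣m (gcd L₁ S₁) (gcd L₂ S₂)) (gcd[m,n]∣m L₁ S₁)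
  d∣S₁ : d ∣ S₁
  d∣S₁ = ∣-trans (gcd[m,n]∣m (gcd L₁ S₁) (gcd L₂ S₂)) (gcd[m,n]∣n L₁ S₁)
  d∣L₂ : d ∣ L₂
  d∣L₂ = ∣-trans (gcd[m,n]∣n (gcd L₁ S₁) (gcd L₂ S₂)) (gcd[m,n]∣m L₂ S₂)
  d∣S₂ : d ∣ S₂
  d∣S₂ = ∣-trans (gcd[m,n]∣n (gcd L₁ S₁) (gcd L₂ S₂)) (gcd[m,n]∣n L₂ S₂)
  module First  = FirstDigits l₁ S₁ 1≤K₁ d d∣L₁ d∣S₁
  module Second = FirstDigits l₂ S₂ 1≤K₂ d d∣L₂ d∣S₂
  d≡1 : ∀ N → ξ L₁ S₁ N <ₗ inv K₁ within (L₁ , S₁) → (1ℚ ℚ.- inv K₂²-1) <ᵣ ξ L₂ S₂ N within (L₂ , S₂) → d ≡ 1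
  d≡1 N ξ₁<1/K₁ 1-1/K₂²<ξ₂ with Second.above-last-interval N (ℕtoℚ-*-inv K₂²-1) (Order.<ᵣ⇒≺ l₂ S₂ 1-1/K₂²<ξ₂)
  ... | b , N≡b , b+1≡L₂+S₂ = residues-collide
    (First.below-first-interval N (ℕtoℚ-*-inv K₁) (Order.<ₗ⇒≺ l₁ S₁ ξ₁<1/K₁)) N≡b
    (subst (d ∣_) (≡-sym b+1≡L₂+S₂) (∣m∣n⇒∣m+n d∣L₂ d∣S₂))
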